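{- Let $n=4k$, let $a_1$ be a nonsquare in $\mathbb{F}_{3^n}$, let $I$ be a primitive $4$th root of unity in $\mathbb{F}_{3^n}$, and define $$a_2=\pm I^k a_1^{(3^k+1)/2}\Big((-1)^k a_1^{(3^k-1)(3^{2k}+1)/4}+a_1^{ -(3^k-1)(3^{2k}+1)/4}\Big)$$ with an arbitrary choice of sign. Then there exists a unique set $V$ of the form $V=\beta\,\mathbb{F}_{3^{2k}}$ with $\beta\in\mathbb{F}_{3^n}^*$ such that for every $c\in V$, $$\operatorname{Tr}^n_{2k}\big(a_2c^{2\cdot 3^k}\big)=0\quad\text{and}\quad c^2\big(a_1+a_1^{3^k}c^{2(3^{2k}-1)}+a_2c^{3^{2k}-1}\big)=0.$$ Moreover, every $c\in V$ also satisfies $$\operatorname{Tr}^n_{2k}\big(a_1c^{2(3^k+1)}\big)=0\quad\text{and}\quad c^{3^k+1}\big(-a_1^{3^k}c^{3^{2k}-1}+a_2+a_2^{3^k}c^{(3^k+1)(3^{2k}-1)}\big)=0.$$ Also, the orthogonal $V^{\perp}=\{y:\operatorname{Tr}_n(yv)=0\ \forall v\in V\}$ is a subspace supplementary to $V$ in $\mathbb{F}_{3^n}$.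
   Context: For $k\mid n$, $\operatorname{Tr}^n_k(x)=\sum_{i=0}^{n/k-1}x^{3^{ik}}$ is the trace from $\mathbb{F}_{3^n}$ to $\mathbb{F}_{3^k}$, and $\operatorname{Tr}_n=\operatorname{Tr}^n_1$. "Supplementary" means $V\oplus V^{\perp}=\mathbb{F}_{3^n}$ as $\mathbb{F}_3$-vector spaces. -}

module Defs where

open import Level using (Level; _⊔_) renaming (suc to lsuc)
open import Data.Nat using (ℕ; zero; suc) renaming (_^_ to _^ℕ_; _+_ to _+ℕ_; _*_ to _*ℕ_)
open import Data.Fin using (Fin)
open import Data.Product using (∃; ∃-syntax; _×_)
open import Relation.Binary.PropositionalEquality using (_≡_)
open import Relation.Binary.Definitions using (Decidable)
open import Relation.Nullary using (¬_)
open import Algebra.Bundles using (CommutativeRing)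

record GF3 (n : ℕ) (c ℓ : Level) : Set (lsuc (c ⊔ ℓ)) where
  field
    cring : CommutativeRing c ℓ
  open CommutativeRing cring public
  field
    _≟_       : Decidable _≈_
    1≉0       : ¬ (1# ≈ 0#)
    _⁻¹       : Carrier → Carrier
    ⁻¹-inv    : ∀ x → ¬ (x ≈ 0#) → x * (x ⁻¹) ≈ 1#
    char3     : 1# + 1# + 1# ≈ 0#
    enum      : Fin (3 ^ℕ n) → Carrier
    enum-surj : ∀ x → ∃[ i ] (enum i ≈ x)
    enum-inj  : ∀ i j → enum i ≈ enum j → i ≡ j

  infixr 8 _^_
  _^_ : Carrier → ℕ → Carrier
  x ^ zero  = 1#
  x ^ suc m = x * (x ^ m)

  -- Σ_{i<d} x^(3^(i m)) : for m ∣ n and d = n/m this is Tr^n_m(x)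
  relTr : (m d : ℕ) → Carrier → Carrier
  relTr m zero    x = 0#
  relTr m (suc d) x = (x ^ (3 ^ℕ (d *ℕ m))) + relTr m d x

  Tr : Carrier → Carrier
  Tr x = relTr 1 n x

  NonSquare : Carrier → Set (c ⊔ ℓ)
  NonSquare a = ¬ (∃[ y ] (y * y ≈ a))

  Primitive4thRoot : Carrier → Set ℓ
  Primitive4thRoot I = (I ^ 4 ≈ 1#) × ¬ (I ^ 1 ≈ 1#) × ¬ (I ^ 2 ≈ 1#) × ¬ (I ^ 3 ≈ 1#)

  Sub : ℕ → Carrier → Set ℓ
  Sub m x = x ^ (3 ^ℕ m) ≈ x

  scaledSub : Carrier → ℕ → Carrier → Set (c ⊔ ℓ)
  scaledSub β m z = ∃[ x ] (Sub m x × z ≈ β * x)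

  SameSet : (Carrier → Set (c ⊔ ℓ)) → (Carrier → Set (c ⊔ ℓ)) → Set (c ⊔ ℓ)
  SameSet V W = (∀ z → V z → W z) × (∀ z → W z → V z)

  Perp : (Carrier → Set (c ⊔ ℓ)) → Carrier → Set (c ⊔ ℓ)
  Perp V y = ∀ v → V v → Tr (y * v) ≈ 0#

  -- W is an F_3-subspace (closed under 0, +, negation; F_3-scalars are then automatic)
  IsSubspace : (Carrier → Set (c ⊔ ℓ)) → Set (c ⊔ ℓ)
  IsSubspace W = W 0# × (∀ x y → W x → W y → W (x + y)) × (∀ x → W x → W (- x))
               × (∀ x y → x ≈ y → W x → W y)

  Supplementary : (Carrier → Set (c ⊔ ℓ)) → (Carrier → Set (c ⊔ ℓ)) → Set (c ⊔ ℓ)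
  Supplementary V W = (∀ z → V z → W z → z ≈ 0#)
                    × (∀ z → ∃[ v ] ∃[ w ] (V v × W w × z ≈ v + w))

{-# OPTIONS --safe #-}

-- Write q = 3ᵏ and Q = 3²ᵏ. A set β F_Q is {z | z ^ Q = w z} with w = β ^ (Q - 1), so the
-- conditions P₁ only involve w: they say a₁ + a₁ ^ q w² + a₂ w = 0 and a₂ ^ Q w ^ 2q = -a₂.
-- Using Euler's criterion a₁ ^ ((3ⁿ - 1) / 2) = -1 one checks that w = -σ (-I)ᵏ a₁ ^ ρ, with
-- ρ = (q - 1)(Q - 1) / 4, satisfies both and has norm w ^ (Q + 1) = 1, so β exists by Hilbert 90.
-- Conversely the trace condition determines w² (Frobenius is injective) and then the quadratic
-- determines w, whence uniqueness; P₂ follows from the same identities. Finally Tr factors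
-- through the relative trace to F_Q, and Tr^{4k}_{2k} (β²) = (1 + w²) β² ≠ 0 makes β F_Q and its
-- orthogonal supplementary, the trace form being nondegenerate. The finite-field facts used
-- (Fermat, Euler's criterion, nondegeneracy of the trace form) follow from |F| = 3ⁿ by bounding
-- the number of roots of polynomial functions.
module Submission where

open import Defs
open import Level using (Level; _⊔_)
open import Data.Nat using (ℕ; _≤_; _∸_; _/_) renaming (_^_ to _^ℕ_; _+_ to _+ℕ_; _*_ to _*ℕ_)
open import Data.Product using (∃; ∃-syntax; _×_)
open import Data.Sum using (_⊎_)
open import Relation.Nullary using (¬_)

open import Algebra using (RawRing)
import Algebra.Properties.CommutativeSemiring.Exp
open import Algebra.Solver.Ring.AlmostCommutativeRing using (fromCommutativeRing; _-Raw-AlmostCommutative⟶_)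
open import Data.Empty using (⊥-elim)
open import Data.Fin using (Fin; zero; suc)
import Data.Fin.Properties as Fin
open import Data.Maybe using (Maybe; just; nothing)
open import Data.Nat using (zero; suc; pred; _<_; z≤n; s≤s; ≢-nonZero)
open import Data.Nat.Tactic.RingSolver using (solve-∀)
open import Data.Nat.DivMod using (m*n/n≡m)
import Data.Nat.Properties as ℕ
open import Data.Product using (_,_; proj₁; proj₂)
open import Data.Sum using (inj₁; inj₂; [_,_]′)
open import Relation.Nullary using (yes; no)
import Relation.Binary.PropositionalEquality as ≡
open ≡ using (_≡_; _≢_)

-- Coefficients for the ring solver; over 𝔽₃ rather than ℤ it also uses 1 + 1 + 1 = 0.
data 𝔽₃ : Set where
  0₃ 1₃ 2₃ : 𝔽₃

_+₃_ : 𝔽₃ → 𝔽₃ → 𝔽₃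
0₃ +₃ y  = y
1₃ +₃ 0₃ = 1₃
1₃ +₃ 1₃ = 2₃
1₃ +₃ 2₃ = 0₃
2₃ +₃ 0₃ = 2₃
2₃ +₃ 1₃ = 0₃
2₃ +₃ 2₃ = 1₃

_*₃_ : 𝔽₃ → 𝔽₃ → 𝔽₃
0₃ *₃ y  = 0₃
1₃ *₃ y  = y
2₃ *₃ 0₃ = 0₃
2₃ *₃ 1₃ = 2₃
2₃ *₃ 2₃ = 1₃

-₃_ : 𝔽₃ → 𝔽₃
-₃ 0₃ = 0₃
-₃ 1₃ = 2₃
-₃ 2₃ = 1₃

𝔽₃-rawRing : RawRing _ _
𝔽₃-rawRing = record
  { Carrier = 𝔽₃ ; _≈_ = _≡_ ; _+_ = _+₃_ ; _*_ = _*₃_ ; -_ = -₃_ ; 0# = 0₃ ; 1# = 1₃ }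

module FiniteField {c ℓ n} (F : GF3 n c ℓ) where
  open GF3 F hiding (zero)
  open import Relation.Binary.Reasoning.Setoid setoid
  open import Algebra.Properties.Ring ring using (-1*x≈-x; -‿distribˡ-*)
  open import Algebra.Properties.AbelianGroup +-abelianGroup
    using (inverseˡ-unique; inverseʳ-unique; ⁻¹-∙-comm; x∙y⁻¹≈ε⇒x≈y; x≈y⇒x∙y⁻¹≈ε)
    renaming (⁻¹-involutive to -‿involutive; ε⁻¹≈ε to -0≈0)

  x-y≈0⇒x≈y : ∀ {x y} → x - y ≈ 0# → x ≈ y
  x-y≈0⇒x≈y = x∙y⁻¹≈ε⇒x≈y _ _

  x≈y⇒x-y≈0 : ∀ {x y} → x ≈ y → x - y ≈ 0#
  x≈y⇒x-y≈0 = x≈y⇒x∙y⁻¹≈ε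

  x+y≈0⇒x≈-y : ∀ {x y} → x + y ≈ 0# → x ≈ - y
  x+y≈0⇒x≈-y = inverseˡ-unique _ _

  x+y≈0⇒y≈-x : ∀ {x y} → x + y ≈ 0# → y ≈ - x
  x+y≈0⇒y≈-x = inverseʳ-unique _ _

  1+1≈-1 : 1# + 1# ≈ - 1#
  1+1≈-1 = inverseʳ-unique 1# (1# + 1#) (trans (sym (+-assoc _ _ _)) char3)

  -1*-1≈1 : - 1# * - 1# ≈ 1#
  -1*-1≈1 = trans (-1*x≈-x (- 1#)) (-‿involutive 1#)

  ⟦_⟧₃ : 𝔽₃ → Carrier
  ⟦ 0₃ ⟧₃ = 0#
  ⟦ 1₃ ⟧₃ = 1#
  ⟦ 2₃ ⟧₃ = - 1#

  ⟦⟧₃-homomorphism : 𝔽₃-rawRing -Raw-AlmostCommutative⟶ fromCommutativeRing cring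
  ⟦⟧₃-homomorphism = record
    { ⟦_⟧ = ⟦_⟧₃ ; +-homo = +-homo ; *-homo = *-homo ; -‿homo = -‿homo ; 0-homo = refl ; 1-homo = refl }
    where
    +-homo : ∀ x y → ⟦ x +₃ y ⟧₃ ≈ ⟦ x ⟧₃ + ⟦ y ⟧₃
    +-homo 0₃ y  = sym (+-identityˡ _)
    +-homo 1₃ 0₃ = sym (+-identityʳ _)
    +-homo 1₃ 1₃ = sym 1+1≈-1
    +-homo 1₃ 2₃ = sym (-‿inverseʳ _)
    +-homo 2₃ 0₃ = sym (+-identityʳ _)
    +-homo 2₃ 1₃ = sym (-‿inverseˡ _)
    +-homo 2₃ 2₃ = begin
      1#            ≈⟨ -‿involutive 1# ⟨
      - - 1#        ≈⟨ -‿cong 1+1≈-1 ⟨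
      - (1# + 1#)   ≈⟨ ⁻¹-∙-comm 1# 1# ⟨
      - 1# + - 1#   ∎
    *-homo : ∀ x y → ⟦ x *₃ y ⟧₃ ≈ ⟦ x ⟧₃ * ⟦ y ⟧₃
    *-homo 0₃ y  = sym (zeroˡ _)
    *-homo 1₃ y  = sym (*-identityˡ _)
    *-homo 2₃ 0₃ = sym (zeroʳ _)
    *-homo 2₃ 1₃ = sym (*-identityʳ _)
    *-homo 2₃ 2₃ = sym -1*-1≈1
    -‿homo : ∀ x → ⟦ -₃ x ⟧₃ ≈ - ⟦ x ⟧₃
    -‿homo 0₃ = sym -0≈0
    -‿homo 1₃ = refl
    -‿homo 2₃ = sym (-‿involutive 1#)

  ⟦⟧₃-≟ : ∀ x y → Maybe (⟦ x ⟧₃ ≈ ⟦ y ⟧₃)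
  ⟦⟧₃-≟ 0₃ 0₃ = just refl
  ⟦⟧₃-≟ 1₃ 1₃ = just refl
  ⟦⟧₃-≟ 2₃ 2₃ = just refl
  ⟦⟧₃-≟ _  _  = nothing

  open import Algebra.Solver.Ring 𝔽₃-rawRing (fromCommutativeRing cring) ⟦⟧₃-homomorphism ⟦⟧₃-≟ public
    using (solve; _:=_; _:+_; _:*_; :-_; _:-_; con)

  module Exp = Algebra.Properties.CommutativeSemiring.Exp commutativeSemiring

  ^≡^ : ∀ x m → x ^ m ≡ x Exp.^ m
  ^≡^ x zero    = ≡.refl
  ^≡^ x (suc m) = ≡.cong (x *_) (^≡^ x m)

  ^-congˡ : ∀ m {x y} → x ≈ y → x ^ m ≈ y ^ m
  ^-congˡ m {x} {y} x≈y rewrite ^≡^ x m | ^≡^ y m = Exp.^-congˡ m x≈y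

  ^-congʳ : ∀ x {m k} → m ≡ k → x ^ m ≈ x ^ k
  ^-congʳ x m≡k = reflexive (≡.cong (x ^_) m≡k)

  ^-homo-* : ∀ x m k → x ^ (m +ℕ k) ≈ x ^ m * x ^ k
  ^-homo-* x m k rewrite ^≡^ x (m +ℕ k) | ^≡^ x m | ^≡^ x k = Exp.^-homo-* x m k

  ^-assocʳ : ∀ x m k → (x ^ m) ^ k ≈ x ^ (m *ℕ k)
  ^-assocʳ x m k rewrite ^≡^ (x ^ m) k | ^≡^ x m | ^≡^ x (m *ℕ k) = Exp.^-assocʳ x m k

  ^-distrib-* : ∀ x y m → (x * y) ^ m ≈ x ^ m * y ^ m
  ^-distrib-* x y m rewrite ^≡^ (x * y) m | ^≡^ x m | ^≡^ y m = Exp.^-distrib-* x y m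

  ^-comm : ∀ x m k → (x ^ m) ^ k ≈ (x ^ k) ^ m
  ^-comm x m k = trans (^-assocʳ x m k) (trans (^-congʳ x (ℕ.*-comm m k)) (sym (^-assocʳ x k m)))

  ^-zeroˡ : ∀ m → 1# ^ m ≈ 1#
  ^-zeroˡ zero    = refl
  ^-zeroˡ (suc m) = trans (*-identityˡ _) (^-zeroˡ m)

  x^2≈x*x : ∀ x → x ^ 2 ≈ x * x
  x^2≈x*x x = *-congˡ (*-identityʳ x)

  x^[2j]≈[x*x]^j : ∀ x j → x ^ (2 *ℕ j) ≈ (x * x) ^ j
  x^[2j]≈[x*x]^j x j = trans (sym (^-assocʳ x 2 j)) (^-congˡ j (x^2≈x*x x))

  x^[2j]≈x^j*x^j : ∀ x j → x ^ (2 *ℕ j) ≈ x ^ j * x ^ j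
  x^[2j]≈x^j*x^j x j = trans (x^[2j]≈[x*x]^j x j) (^-distrib-* x x j)

  x≈0⇒x^[1+j]≈0 : ∀ {x} j → x ≈ 0# → x ^ suc j ≈ 0#
  x≈0⇒x^[1+j]≈0 j x≈0 = trans (*-congʳ x≈0) (zeroˡ _)

  x*x≈1⇒x^even≈1 : ∀ {x} j → x * x ≈ 1# → x ^ (2 *ℕ j) ≈ 1#
  x*x≈1⇒x^even≈1 {x} j xx≈1 = trans (x^[2j]≈[x*x]^j x j) (trans (^-congˡ j xx≈1) (^-zeroˡ j))

  x*x≈1⇒x^odd≈x : ∀ {x} j → x * x ≈ 1# → x ^ suc (2 *ℕ j) ≈ x
  x*x≈1⇒x^odd≈x j xx≈1 = trans (*-congˡ (x*x≈1⇒x^even≈1 j xx≈1)) (*-identityʳ _)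

  x⁻¹*x≈1 : ∀ {x} → ¬ x ≈ 0# → x ⁻¹ * x ≈ 1#
  x⁻¹*x≈1 x≉0 = trans (*-comm _ _) (⁻¹-inv _ x≉0)

  *-cancelˡ : ∀ {a x y} → ¬ a ≈ 0# → a * x ≈ a * y → x ≈ y
  *-cancelˡ {a} {x} {y} a≉0 ax≈ay = begin
    x                 ≈⟨ *-identityˡ x ⟨
    1# * x            ≈⟨ *-congʳ (x⁻¹*x≈1 a≉0) ⟨
    (a ⁻¹ * a) * x    ≈⟨ *-assoc _ _ _ ⟩
    a ⁻¹ * (a * x)    ≈⟨ *-congˡ ax≈ay ⟩
    a ⁻¹ * (a * y)    ≈⟨ *-assoc _ _ _ ⟨
    (a ⁻¹ * a) * y    ≈⟨ *-congʳ (x⁻¹*x≈1 a≉0) ⟩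
    1# * y            ≈⟨ *-identityˡ y ⟩
    y                 ∎

  *-cancelʳ : ∀ {a x y} → ¬ a ≈ 0# → x * a ≈ y * a → x ≈ y
  *-cancelʳ a≉0 xa≈ya = *-cancelˡ a≉0 (trans (*-comm _ _) (trans xa≈ya (*-comm _ _)))

  zero-product : ∀ {x y} → x * y ≈ 0# → x ≈ 0# ⊎ y ≈ 0#
  zero-product {x} xy≈0 with x ≟ 0#
  ... | yes x≈0 = inj₁ x≈0
  ... | no  x≉0 = inj₂ (*-cancelˡ x≉0 (trans xy≈0 (sym (zeroʳ x))))

  *-nonzero : ∀ {x y} → ¬ x ≈ 0# → ¬ y ≈ 0# → ¬ x * y ≈ 0#
  *-nonzero x≉0 y≉0 xy≈0 = [ x≉0 , y≉0 ]′ (zero-product xy≈0)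

  ^-nonzero : ∀ {x} m → ¬ x ≈ 0# → ¬ x ^ m ≈ 0#
  ^-nonzero zero    x≉0 = 1≉0
  ^-nonzero (suc m) x≉0 = *-nonzero x≉0 (^-nonzero m x≉0)

  x*x≈1⇒x≈±1 : ∀ {x} → x * x ≈ 1# → x ≈ 1# ⊎ x ≈ - 1#
  x*x≈1⇒x≈±1 {x} xx≈1 with zero-product {x - 1#} {x + 1#} (begin
    (x - 1#) * (x + 1#)  ≈⟨ solve 1 (λ x → (x :- con 1₃) :* (x :+ con 1₃) := x :* x :- con 1₃) refl x ⟩
    x * x - 1#           ≈⟨ x≈y⇒x-y≈0 xx≈1 ⟩
    0#                   ∎)
  ... | inj₁ x-1≈0 = inj₁ (x-y≈0⇒x≈y x-1≈0)
  ... | inj₂ x+1≈0 = inj₂ (x+y≈0⇒y≈-x (trans (+-comm _ _) x+1≈0))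

  1≉-1 : ¬ 1# ≈ - 1#
  1≉-1 1≈-1 = 1≉0 (begin
    1#                 ≈⟨ solve 0 (con 1₃ := (con 1₃ :- con 2₃) :* con 2₃) refl ⟩
    (1# - - 1#) * - 1# ≈⟨ *-congʳ (x≈y⇒x-y≈0 1≈-1) ⟩
    0# * - 1#          ≈⟨ zeroˡ _ ⟩
    0#                 ∎)

  -- Frobenius and Fermat's little theorem

  3^m≡suc : ∀ m → 3 ^ℕ m ≡ suc (3 ^ℕ m ∸ 1)
  3^m≡suc m = ≡.sym (ℕ.suc-pred (3 ^ℕ m) {{ℕ.m^n≢0 3 m}})

  0^3^m≈0 : ∀ m → 0# ^ (3 ^ℕ m) ≈ 0#
  0^3^m≈0 m = trans (^-congʳ 0# (3^m≡suc m)) (zeroˡ _)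

  frobenius-+ : ∀ m x y → (x + y) ^ (3 ^ℕ m) ≈ x ^ (3 ^ℕ m) + y ^ (3 ^ℕ m)
  frobenius-+ zero    x y = trans (*-identityʳ _) (sym (+-cong (*-identityʳ x) (*-identityʳ y)))
  frobenius-+ (suc m) x y = begin
    (x + y) ^ (3 *ℕ 3 ^ℕ m)                  ≈⟨ ^-assocʳ (x + y) 3 (3 ^ℕ m) ⟨
    ((x + y) ^ 3) ^ (3 ^ℕ m)                 ≈⟨ ^-congˡ (3 ^ℕ m) cube-+ ⟩
    (x ^ 3 + y ^ 3) ^ (3 ^ℕ m)               ≈⟨ frobenius-+ m (x ^ 3) (y ^ 3) ⟩
    (x ^ 3) ^ (3 ^ℕ m) + (y ^ 3) ^ (3 ^ℕ m)  ≈⟨ +-cong (^-assocʳ x 3 (3 ^ℕ m)) (^-assocʳ y 3 (3 ^ℕ m)) ⟩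
    x ^ (3 *ℕ 3 ^ℕ m) + y ^ (3 *ℕ 3 ^ℕ m)    ∎
    where
    cube-+ : (x + y) ^ 3 ≈ x ^ 3 + y ^ 3
    cube-+ = solve 2 (λ x y → (x :+ y) :* ((x :+ y) :* ((x :+ y) :* con 1₃))
                              := x :* (x :* (x :* con 1₃)) :+ y :* (y :* (y :* con 1₃))) refl x y

  frobenius-neg : ∀ m x → (- x) ^ (3 ^ℕ m) ≈ - x ^ (3 ^ℕ m)
  frobenius-neg m x = inverseʳ-unique _ _ (begin
    x ^ (3 ^ℕ m) + (- x) ^ (3 ^ℕ m)  ≈⟨ frobenius-+ m x (- x) ⟨
    (x - x) ^ (3 ^ℕ m)               ≈⟨ ^-congˡ (3 ^ℕ m) (-‿inverseʳ x) ⟩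
    0# ^ (3 ^ℕ m)                    ≈⟨ 0^3^m≈0 m ⟩
    0#                               ∎)

  frobenius-− : ∀ m x y → (x - y) ^ (3 ^ℕ m) ≈ x ^ (3 ^ℕ m) - y ^ (3 ^ℕ m)
  frobenius-− m x y = trans (frobenius-+ m x (- y)) (+-congˡ (frobenius-neg m y))

  frobenius-injective : ∀ m {x y} → x ^ (3 ^ℕ m) ≈ y ^ (3 ^ℕ m) → x ≈ y
  frobenius-injective m {x} {y} xᵠ≈yᵠ with (x - y) ≟ 0#
  ... | yes x-y≈0 = x-y≈0⇒x≈y x-y≈0
  ... | no  x-y≉0 = ⊥-elim (^-nonzero (3 ^ℕ m) x-y≉0 (trans (frobenius-− m x y) (x≈y⇒x-y≈0 xᵠ≈yᵠ)))

  index : Carrier → Fin (3 ^ℕ n)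
  index x = proj₁ (enum-surj x)

  enum-index : ∀ x → enum (index x) ≈ x
  enum-index x = proj₂ (enum-surj x)

  n≢0 : n ≢ 0
  n≢0 ≡.refl with index 0# | enum-index 0# | index 1# | enum-index 1#
  ... | zero | e₀ | zero | e₁ = 1≉0 (trans (sym e₁) e₀)

  module _ where
    open import Algebra.Properties.CommutativeMonoid.Sum *-commutativeMonoid
      using (sum-permute; sum-cong-≋; ∑-distrib-+; sum-replicate) renaming (sum to ∏)
    open import Data.Fin.Permutation using (Permutation; permutation; _⟨$⟩ʳ_)

    ∏-update : ∀ {m} a (f g : Fin m → Carrier) i →
               f i ≈ a * g i → (∀ j → j ≢ i → f j ≈ g j) → ∏ f ≈ a * ∏ g
    ∏-update a f g zero fi≈agi fj≈gj = begin
      f zero * ∏ (λ j → f (suc j))      ≈⟨ *-cong fi≈agi (sum-cong-≋ (λ j → fj≈gj (suc j) λ ())) ⟩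
      a * g zero * ∏ (λ j → g (suc j))  ≈⟨ *-assoc _ _ _ ⟩
      a * ∏ g                           ∎
    ∏-update a f g (suc i) fi≈agi fj≈gj = begin
      f zero * ∏ (λ j → f (suc j))        ≈⟨ *-cong (fj≈gj zero λ ()) (∏-update a (λ j → f (suc j)) (λ j → g (suc j)) i fi≈agi
                                                      (λ j j≢i → fj≈gj (suc j) (λ sj≡si → j≢i (Fin.suc-injective sj≡si)))) ⟩
      g zero * (a * ∏ (λ j → g (suc j)))  ≈⟨ solve 3 (λ x a y → x :* (a :* y) := a :* (x :* y)) refl (g zero) a _ ⟩
      a * ∏ g                             ∎

    ∏-nonzero : ∀ {m} (f : Fin m → Carrier) → (∀ i → ¬ f i ≈ 0#) → ¬ ∏ f ≈ 0#
    ∏-nonzero {zero}  f fᵢ≉0 = 1≉0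
    ∏-nonzero {suc m} f fᵢ≉0 = *-nonzero (fᵢ≉0 zero) (∏-nonzero (λ i → f (suc i)) (λ i → fᵢ≉0 (suc i)))

    scaling : ∀ {a} → ¬ a ≈ 0# → Permutation (3 ^ℕ n) (3 ^ℕ n)
    scaling {a} a≉0 = permutation (λ i → index (a * enum i)) (λ i → index (a ⁻¹ * enum i))
      (λ i → enum-inj _ _ (begin
        enum (index (a * enum (index (a ⁻¹ * enum i))))  ≈⟨ trans (enum-index _) (*-congˡ (enum-index _)) ⟩
        a * (a ⁻¹ * enum i)                               ≈⟨ trans (sym (*-assoc _ _ _)) (*-congʳ (⁻¹-inv a a≉0)) ⟩
        1# * enum i                                       ≈⟨ *-identityˡ _ ⟩
        enum i                                            ∎))
      (λ i → enum-inj _ _ (begin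
        enum (index (a ⁻¹ * enum (index (a * enum i))))  ≈⟨ trans (enum-index _) (*-congˡ (enum-index _)) ⟩
        a ⁻¹ * (a * enum i)                               ≈⟨ trans (sym (*-assoc _ _ _)) (*-congʳ (x⁻¹*x≈1 a≉0)) ⟩
        1# * enum i                                       ≈⟨ *-identityˡ _ ⟩
        enum i                                            ∎))

    nonzeroPart : Carrier → Carrier
    nonzeroPart x with x ≟ 0#
    ... | yes _ = 1#
    ... | no  _ = x

    nonzeroPart-nonzero : ∀ x → ¬ nonzeroPart x ≈ 0#
    nonzeroPart-nonzero x with x ≟ 0#
    ... | yes _   = 1≉0
    ... | no  x≉0 = x≉0

    nonzeroPart-cong : ∀ {x y} → x ≈ y → nonzeroPart x ≈ nonzeroPart y
    nonzeroPart-cong {x} {y} x≈y with x ≟ 0# | y ≟ 0#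
    ... | yes _   | yes _   = refl
    ... | yes x≈0 | no  y≉0 = ⊥-elim (y≉0 (trans (sym x≈y) x≈0))
    ... | no  x≉0 | yes y≈0 = ⊥-elim (x≉0 (trans x≈y y≈0))
    ... | no  _   | no  _   = x≈y

    nonzeroPart-0 : ∀ {x} → x ≈ 0# → nonzeroPart x ≈ 1#
    nonzeroPart-0 {x} x≈0 with x ≟ 0#
    ... | yes _   = refl
    ... | no  x≉0 = ⊥-elim (x≉0 x≈0)

    nonzeroPart-* : ∀ {a x} → ¬ a ≈ 0# → ¬ x ≈ 0# → nonzeroPart (a * x) ≈ a * nonzeroPart x
    nonzeroPart-* {a} {x} a≉0 x≉0 with x ≟ 0# | (a * x) ≟ 0#
    ... | yes x≈0 | _        = ⊥-elim (x≉0 x≈0)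
    ... | no  _   | yes ax≈0 = ⊥-elim (*-nonzero a≉0 x≉0 ax≈0)
    ... | no  _   | no  _    = refl

    -- x ↦ a x permutes F and multiplies every factor of ∏ₓ nonzeroPart x by a, except the
    -- one at x = 0; hence a * ∏ = a ^ 3ⁿ * ∏.
    fermat-nonzero : ∀ {a} → ¬ a ≈ 0# → a ^ (3 ^ℕ n) ≈ a
    fermat-nonzero {a} a≉0 = *-cancelʳ (∏-nonzero U (λ i → nonzeroPart-nonzero (enum i))) (begin
      a ^ (3 ^ℕ n) * ∏ U                      ≈⟨ *-congʳ (reflexive (^≡^ a (3 ^ℕ n))) ⟩
      a Exp.^ (3 ^ℕ n) * ∏ U                  ≈⟨ *-congʳ (sum-replicate (3 ^ℕ n) {a}) ⟨
      ∏ (λ (_ : Fin (3 ^ℕ n)) → a) * ∏ U      ≈⟨ ∑-distrib-+ (λ _ → a) U ⟨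
      ∏ (λ i → a * U i)                       ≈⟨ ∏-update a _ aU i₀ (*-congˡ factor-at-0) factor-elsewhere ⟩
      a * ∏ aU                                ≈⟨ *-congˡ (sum-cong-≋ {3 ^ℕ n} (λ i → nonzeroPart-cong (enum-index (a * enum i)))) ⟨
      a * ∏ (λ i → U (σ ⟨$⟩ʳ i))              ≈⟨ *-congˡ (sum-permute U σ) ⟨
      a * ∏ U                                 ∎)
      where
      U aU : Fin (3 ^ℕ n) → Carrier
      U i = nonzeroPart (enum i)
      aU i = nonzeroPart (a * enum i)
      σ = scaling a≉0
      i₀ = index 0#
      e₀≈0 = enum-index 0#
      factor-at-0 : U i₀ ≈ aU i₀
      factor-at-0 = trans (nonzeroPart-0 e₀≈0) (sym (nonzeroPart-0 (trans (*-congˡ e₀≈0) (zeroʳ a))))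
      factor-elsewhere : ∀ j → j ≢ i₀ → a * U j ≈ aU j
      factor-elsewhere j j≢i₀ = sym (nonzeroPart-* a≉0 (λ eⱼ≈0 → j≢i₀ (enum-inj _ _ (trans eⱼ≈0 (sym e₀≈0)))))

  fermat : ∀ x → x ^ (3 ^ℕ n) ≈ x
  fermat x with x ≟ 0#
  ... | yes x≈0 = trans (^-congˡ (3 ^ℕ n) x≈0) (trans (0^3^m≈0 n) (sym x≈0))
  ... | no  x≉0 = fermat-nonzero x≉0

  -- Polynomial functions

  -- IsPolynomial d a f: f is a polynomial function of degree ≤ d with coefficient a at xᵈ,
  -- encoded by the factor theorem so that no coefficient lists are needed.
  IsPolynomial : ℕ → Carrier → (Carrier → Carrier) → Set (c ⊔ ℓ)
  IsPolynomial zero    a f = ∀ x → f x ≈ a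
  IsPolynomial (suc d) a f = ∀ r → ∃[ g ] (IsPolynomial d a g × (∀ x → f x - f r ≈ (x - r) * g x))

  IsPolynomial-cong : ∀ d {a b f g} → a ≈ b → (∀ x → f x ≈ g x) → IsPolynomial d a f → IsPolynomial d b g
  IsPolynomial-cong zero    a≈b f≈g f-poly x = trans (sym (f≈g x)) (trans (f-poly x) a≈b)
  IsPolynomial-cong (suc d) a≈b f≈g f-poly r with f-poly r
  ... | h , h-poly , f-factor = h , IsPolynomial-cong d a≈b (λ _ → refl) h-poly ,
                                λ x → trans (+-cong (sym (f≈g x)) (-‿cong (sym (f≈g r)))) (f-factor x)

  IsPolynomial-raise : ∀ d {a f} → IsPolynomial d a f → IsPolynomial (suc d) 0# f
  IsPolynomial-raise zero    {f = f} f-poly r =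
    (λ _ → 0#) , (λ _ → refl) , λ x → trans (x≈y⇒x-y≈0 (trans (f-poly x) (sym (f-poly r)))) (sym (zeroʳ _))
  IsPolynomial-raise (suc d) f-poly r with f-poly r
  ... | h , h-poly , f-factor = h , IsPolynomial-raise d h-poly , f-factor

  IsPolynomial-raise* : ∀ {d e a f} → d < e → IsPolynomial d a f → IsPolynomial e 0# f
  IsPolynomial-raise* {d} {suc e} (s≤s d≤e) f-poly with ℕ.m≤n⇒m<n∨m≡n d≤e
  ... | inj₁ d<e    = IsPolynomial-raise e (IsPolynomial-raise* d<e f-poly)
  ... | inj₂ ≡.refl = IsPolynomial-raise d f-poly

  IsPolynomial-+ : ∀ d {a b f g} → IsPolynomial d a f → IsPolynomial d b g → IsPolynomial d (a + b) (λ x → f x + g x)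
  IsPolynomial-+ zero    f-poly g-poly x = +-cong (f-poly x) (g-poly x)
  IsPolynomial-+ (suc d) {f = f} {g} f-poly g-poly r with f-poly r | g-poly r
  ... | f′ , f′-poly , f-factor | g′ , g′-poly , g-factor =
    (λ x → f′ x + g′ x) , IsPolynomial-+ d f′-poly g′-poly , λ x → begin
      (f x + g x) - (f r + g r)        ≈⟨ solve 4 (λ a b c d → (a :+ b) :- (c :+ d) := (a :- c) :+ (b :- d)) refl (f x) (g x) (f r) (g r) ⟩
      (f x - f r) + (g x - g r)        ≈⟨ +-cong (f-factor x) (g-factor x) ⟩
      (x - r) * f′ x + (x - r) * g′ x  ≈⟨ distribˡ _ _ _ ⟨
      (x - r) * (f′ x + g′ x)          ∎

  IsPolynomial-scale : ∀ d s {a f} → IsPolynomial d a f → IsPolynomial d (s * a) (λ x → s * f x)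
  IsPolynomial-scale zero    s f-poly x = *-congˡ (f-poly x)
  IsPolynomial-scale (suc d) s {f = f} f-poly r with f-poly r
  ... | g , g-poly , f-factor = (λ x → s * g x) , IsPolynomial-scale d s g-poly , λ x → begin
      s * f x - s * f r    ≈⟨ solve 3 (λ s a b → s :* a :- s :* b := s :* (a :- b)) refl s (f x) (f r) ⟩
      s * (f x - f r)      ≈⟨ *-congˡ (f-factor x) ⟩
      s * ((x - r) * g x)  ≈⟨ solve 3 (λ s a b → s :* (a :* b) := a :* (s :* b)) refl s (x - r) (g x) ⟩
      (x - r) * (s * g x)  ∎

  IsPolynomial-x* : ∀ d {a g} → IsPolynomial d a g → IsPolynomial (suc d) a (λ x → x * g x)
  IsPolynomial-x* zero    {g = g} g-poly r = g , g-poly , λ x → begin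
      x * g x - r * g r  ≈⟨ +-congˡ (-‿cong (*-congˡ (trans (g-poly r) (sym (g-poly x))))) ⟩
      x * g x - r * g x  ≈⟨ solve 3 (λ x r y → x :* y :- r :* y := (x :- r) :* y) refl x r (g x) ⟩
      (x - r) * g x      ∎
  IsPolynomial-x* (suc d) {a} {g} g-poly r with g-poly r
  ... | h , h-poly , g-factor =
    (λ x → g x + r * h x) ,
    IsPolynomial-cong (suc d) (trans (+-congˡ (zeroʳ r)) (+-identityʳ a)) (λ _ → refl)
      (IsPolynomial-+ (suc d) g-poly (IsPolynomial-scale (suc d) r (IsPolynomial-raise d h-poly))) ,
    λ x → begin
      x * g x - r * g r                    ≈⟨ solve 4 (λ x r a b → x :* a :- r :* b := (x :- r) :* a :+ r :* (a :- b)) refl x r (g x) (g r) ⟩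
      (x - r) * g x + r * (g x - g r)      ≈⟨ +-congˡ (*-congˡ (g-factor x)) ⟩
      (x - r) * g x + r * ((x - r) * h x)  ≈⟨ solve 4 (λ x r a b → (x :- r) :* a :+ r :* ((x :- r) :* b) := (x :- r) :* (a :+ r :* b)) refl x r (g x) (h x) ⟩
      (x - r) * (g x + r * h x)            ∎

  IsPolynomial-linear : ∀ d c {a f} → IsPolynomial d a f → IsPolynomial (suc d) a (λ x → (x - c) * f x)
  IsPolynomial-linear d c {a} {f} f-poly =
    IsPolynomial-cong (suc d) (+-identityʳ a) (λ x → solve 3 (λ x c y → x :* y :+ (:- c) :* y := (x :- c) :* y) refl x c (f x))
      (IsPolynomial-+ (suc d) (IsPolynomial-x* d f-poly) (IsPolynomial-raise d (IsPolynomial-scale d (- c) f-poly)))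

  IsPolynomial-^ : ∀ m → IsPolynomial m 1# (_^ m)
  IsPolynomial-^ zero    _ = refl
  IsPolynomial-^ (suc m) = IsPolynomial-x* m (IsPolynomial-^ m)

  IsPolynomial-∘square : ∀ d {a g} → IsPolynomial d a g → IsPolynomial (d +ℕ d) a (λ x → g (x * x))
  IsPolynomial-∘square zero    g-poly x = g-poly (x * x)
  IsPolynomial-∘square (suc d) {a} {g} g-poly r with g-poly (r * r)
  ... | h , h-poly , g-factor =
    (λ x → (x - - r) * h (x * x)) ,
    ≡.subst (λ e → IsPolynomial e a (λ x → (x - - r) * h (x * x))) (≡.sym (ℕ.+-suc d d))
      (IsPolynomial-linear (d +ℕ d) (- r) (IsPolynomial-∘square d h-poly)) ,
    λ x → begin
      g (x * x) - g (r * r)              ≈⟨ g-factor (x * x) ⟩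
      (x * x - r * r) * h (x * x)        ≈⟨ solve 3 (λ x r y → (x :* x :- r :* r) :* y := (x :- r) :* ((x :- (:- r)) :* y)) refl x r (h (x * x)) ⟩
      (x - r) * ((x - - r) * h (x * x))  ∎

  roots≤degree : ∀ d {a f m} → IsPolynomial d a f → ¬ a ≈ 0# → (r : Fin m → Carrier) →
                 (∀ i j → r i ≈ r j → i ≡ j) → (∀ i → f (r i) ≈ 0#) → m ≤ d
  roots≤degree d       {m = zero}  _ _ _ _ _ = z≤n
  roots≤degree zero    {m = suc m} f-poly a≉0 r _ f[r]≈0 = ⊥-elim (a≉0 (trans (sym (f-poly (r zero))) (f[r]≈0 zero)))
  roots≤degree (suc d) {f = f} {m = suc m} f-poly a≉0 r r-inj f[r]≈0 with f-poly (r zero)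
  ... | g , g-poly , f-factor =
    s≤s (roots≤degree d g-poly a≉0 (λ i → r (suc i)) (λ i j rᵢ≈rⱼ → Fin.suc-injective (r-inj _ _ rᵢ≈rⱼ)) g[r]≈0)
    where
    g[r]≈0 : ∀ i → g (r (suc i)) ≈ 0#
    g[r]≈0 i with zero-product (trans (sym (f-factor (r (suc i)))) (x≈y⇒x-y≈0 (trans (f[r]≈0 (suc i)) (sym (f[r]≈0 zero)))))
    ... | inj₁ rᵢ-r₀≈0 = ⊥-elim (Fin.0≢1+n (r-inj _ _ (sym (x-y≈0⇒x≈y rᵢ-r₀≈0))))
    ... | inj₂ g[rᵢ]≈0  = g[rᵢ]≈0

  vanishing⇒3^n≤degree : ∀ d {a f} → IsPolynomial d a f → ¬ a ≈ 0# → (∀ x → f x ≈ 0#) → 3 ^ℕ n ≤ d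
  vanishing⇒3^n≤degree d f-poly a≉0 f≈0 = roots≤degree d f-poly a≉0 enum enum-inj (λ i → f≈0 (enum i))

  x^[3ⁿ-1]≈1 : ∀ {e x} → 3 ^ℕ n ≡ suc e → ¬ x ≈ 0# → x ^ e ≈ 1#
  x^[3ⁿ-1]≈1 {e} {x} 3ⁿ≡1+e x≉0 = *-cancelˡ x≉0 (begin
    x * x ^ e      ≈⟨ ^-congʳ x 3ⁿ≡1+e ⟨
    x ^ (3 ^ℕ n)   ≈⟨ fermat x ⟩
    x              ≈⟨ *-identityʳ x ⟨
    x * 1#         ∎)

  nonsquare-nonzero : ∀ {A} → NonSquare A → ¬ A ≈ 0#
  nonsquare-nonzero A-nonsquare A≈0 = A-nonsquare (0# , trans (zeroˡ 0#) (sym A≈0))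

  -- If A ^ h = 1, dividing yʰ - 1 by y - A leaves g of degree h - 1 with g (t²) = 0 for all
  -- t ≠ 0 (as t² ≠ A); then t ↦ t g (t²), of degree 2h - 1, vanishes on all 2h + 1 elements.
  euler-criterion : ∀ {A} h → 3 ^ℕ n ≡ suc (h +ℕ h) → NonSquare A → A ^ h ≈ - 1#
  euler-criterion zero 3ⁿ≡1 _ with ℕ.m^n≡1⇒n≡0∨m≡1 3 n 3ⁿ≡1
  ... | inj₁ n≡0 = ⊥-elim (n≢0 n≡0)
  euler-criterion {A} h@(suc h′) 3ⁿ≡1+2h A-nonsquare
    with x*x≈1⇒x≈±1 (trans (sym (^-homo-* A h h)) (x^[3ⁿ-1]≈1 3ⁿ≡1+2h (nonsquare-nonzero A-nonsquare)))
  ... | inj₂ Aʰ≈-1 = Aʰ≈-1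
  ... | inj₁ Aʰ≈1 with IsPolynomial-cong h (+-identityʳ 1#) (λ _ → refl)
                         (IsPolynomial-+ h (IsPolynomial-^ h) (IsPolynomial-raise* (s≤s z≤n) (λ _ → refl))) A
  ... | g , g-poly , f-factor = ⊥-elim (ℕ.<⇒≱ 2h′+1<3ⁿ (vanishing⇒3^n≤degree (suc (h′ +ℕ h′))
          (IsPolynomial-x* (h′ +ℕ h′) (IsPolynomial-∘square h′ g-poly)) 1≉0 tg[t²]≈0))
    where
    2h′+1<3ⁿ : suc (h′ +ℕ h′) < 3 ^ℕ n
    2h′+1<3ⁿ = ≡.subst (suc (h′ +ℕ h′) <_) (≡.sym 3ⁿ≡1+2h) (s≤s (ℕ.+-mono-< (ℕ.n<1+n h′) (ℕ.n<1+n h′)))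
    tg[t²]≈0 : ∀ t → t * g (t * t) ≈ 0#
    tg[t²]≈0 t with t ≟ 0#
    ... | yes t≈0 = trans (*-congʳ t≈0) (zeroˡ _)
    ... | no  t≉0 = [ (λ t²-A≈0 → ⊥-elim (A-nonsquare (t , x-y≈0⇒x≈y t²-A≈0)))
                    , (λ g[t²]≈0 → trans (*-congˡ g[t²]≈0) (zeroʳ t))
                    ]′ (zero-product (begin
        (t * t - A) * g (t * t)            ≈⟨ f-factor (t * t) ⟨
        ((t * t) ^ h - 1#) - (A ^ h - 1#)  ≈⟨ +-cong (+-congʳ t²ʰ≈1) (-‿cong (+-congʳ Aʰ≈1)) ⟩
        (1# - 1#) - (1# - 1#)              ≈⟨ x≈y⇒x-y≈0 refl ⟩
        0#                                 ∎))
      where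
      t²ʰ≈1 : (t * t) ^ h ≈ 1#
      t²ʰ≈1 = trans (^-distrib-* t t h) (trans (sym (^-homo-* t h h)) (x^[3ⁿ-1]≈1 3ⁿ≡1+2h t≉0))

  -- Traces

  relTr-cong : ∀ m d {x y} → x ≈ y → relTr m d x ≈ relTr m d y
  relTr-cong m zero    x≈y = refl
  relTr-cong m (suc d) x≈y = +-cong (^-congˡ (3 ^ℕ (d *ℕ m)) x≈y) (relTr-cong m d x≈y)

  relTr-+ : ∀ m d x y → relTr m d (x + y) ≈ relTr m d x + relTr m d y
  relTr-+ m zero    x y = sym (+-identityʳ 0#)
  relTr-+ m (suc d) x y = begin
    (x + y) ^ 3ᵈᵐ + relTr m d (x + y)               ≈⟨ +-cong (frobenius-+ (d *ℕ m) x y) (relTr-+ m d x y) ⟩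
    (x ^ 3ᵈᵐ + y ^ 3ᵈᵐ) + (relTr m d x + relTr m d y)  ≈⟨ solve 4 (λ a b c d → (a :+ b) :+ (c :+ d) := (a :+ c) :+ (b :+ d)) refl _ _ _ _ ⟩
    (x ^ 3ᵈᵐ + relTr m d x) + (y ^ 3ᵈᵐ + relTr m d y)  ∎
    where 3ᵈᵐ = 3 ^ℕ (d *ℕ m)

  relTr-neg : ∀ m d x → relTr m d (- x) ≈ - relTr m d x
  relTr-neg m zero    x = sym -0≈0
  relTr-neg m (suc d) x = trans (+-cong (frobenius-neg (d *ℕ m) x) (relTr-neg m d x)) (⁻¹-∙-comm _ _)

  relTr-0 : ∀ m d → relTr m d 0# ≈ 0#
  relTr-0 m zero    = refl
  relTr-0 m (suc d) = trans (+-cong (0^3^m≈0 (d *ℕ m)) (relTr-0 m d)) (+-identityʳ 0#)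

  relTr-split : ∀ a b v → relTr 1 (a +ℕ b) v ≈ relTr 1 a (v ^ (3 ^ℕ b)) + relTr 1 b v
  relTr-split zero    b v = sym (+-identityˡ _)
  relTr-split (suc a) b v = begin
    v ^ (3 ^ℕ ((a +ℕ b) *ℕ 1)) + relTr 1 (a +ℕ b) v                        ≈⟨ +-cong (^-congʳ v 3^[a+b]) (relTr-split a b v) ⟩
    v ^ (3 ^ℕ b *ℕ 3 ^ℕ (a *ℕ 1)) + (relTr 1 a (v ^ 3ᵇ) + relTr 1 b v)    ≈⟨ +-congʳ (^-assocʳ v 3ᵇ (3 ^ℕ (a *ℕ 1))) ⟨
    (v ^ 3ᵇ) ^ (3 ^ℕ (a *ℕ 1)) + (relTr 1 a (v ^ 3ᵇ) + relTr 1 b v)       ≈⟨ +-assoc _ _ _ ⟨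
    ((v ^ 3ᵇ) ^ (3 ^ℕ (a *ℕ 1)) + relTr 1 a (v ^ 3ᵇ)) + relTr 1 b v       ∎
    where
    3ᵇ = 3 ^ℕ b
    3^[a+b] : 3 ^ℕ ((a +ℕ b) *ℕ 1) ≡ 3ᵇ *ℕ 3 ^ℕ (a *ℕ 1)
    3^[a+b] = ≡.trans (≡.cong (3 ^ℕ_) (≡.trans (ℕ.*-identityʳ (a +ℕ b)) (≡.trans (ℕ.+-comm a b) (≡.cong (b +ℕ_) (≡.sym (ℕ.*-identityʳ a))))))
                      (ℕ.^-distribˡ-+-* 3 b (a *ℕ 1))

  Perp-isSubspace : ∀ V → IsSubspace (Perp V)
  Perp-isSubspace V =
      (λ v _ → trans (relTr-cong 1 n (zeroˡ v)) (relTr-0 1 n))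
    , (λ x y x⊥V y⊥V v v∈V → begin
        Tr ((x + y) * v)          ≈⟨ relTr-cong 1 n (distribʳ v x y) ⟩
        Tr (x * v + y * v)        ≈⟨ relTr-+ 1 n _ _ ⟩
        Tr (x * v) + Tr (y * v)   ≈⟨ +-cong (x⊥V v v∈V) (y⊥V v v∈V) ⟩
        0# + 0#                   ≈⟨ +-identityʳ 0# ⟩
        0#                        ∎)
    , (λ x x⊥V v v∈V → begin
        Tr (- x * v)    ≈⟨ relTr-cong 1 n (-‿distribˡ-* x v) ⟨
        Tr (- (x * v))  ≈⟨ relTr-neg 1 n _ ⟩
        - Tr (x * v)    ≈⟨ -‿cong (x⊥V v v∈V) ⟩
        - 0#            ≈⟨ -0≈0 ⟩
        0#              ∎)
    , (λ x y x≈y x⊥V v v∈V → trans (relTr-cong 1 n (*-congʳ (sym x≈y))) (x⊥V v v∈V))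

  Tr-polynomial : ∀ m u → IsPolynomial (3 ^ℕ m) (u ^ (3 ^ℕ m)) (λ y → relTr 1 (suc m) (u * y))
  Tr-polynomial m u =
    IsPolynomial-cong (3 ^ℕ m) (trans (+-identityʳ _) (*-identityʳ _)) (λ y → +-congʳ (begin
        u ^ 3ᵐ * y ^ 3ᵐ             ≈⟨ ^-distrib-* u y 3ᵐ ⟨
        (u * y) ^ 3ᵐ                ≈⟨ ^-congʳ (u * y) (≡.cong (3 ^ℕ_) (ℕ.*-identityʳ m)) ⟨
        (u * y) ^ (3 ^ℕ (m *ℕ 1))   ∎))
      (IsPolynomial-+ 3ᵐ (IsPolynomial-scale 3ᵐ (u ^ 3ᵐ) (IsPolynomial-^ 3ᵐ)) (lower-terms m))
    where
    3ᵐ = 3 ^ℕ m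
    lower-terms : ∀ m → IsPolynomial (3 ^ℕ m) 0# (λ y → relTr 1 m (u * y))
    lower-terms zero    = IsPolynomial-raise 0 {f = λ _ → 0#} (λ _ → refl)
    lower-terms (suc m) = IsPolynomial-raise* (ℕ.^-monoʳ-< 3 (s≤s (s≤s z≤n)) (ℕ.n<1+n m)) (Tr-polynomial m u)

  Tr-nondegenerate : ∀ {u} → ¬ u ≈ 0# → ¬ (∀ y → Tr (u * y) ≈ 0#)
  Tr-nondegenerate {u} u≉0 Tr[uy]≈0 = ℕ.<⇒≱ 3ᵐ<3ⁿ
    (vanishing⇒3^n≤degree (3 ^ℕ m) (Tr-polynomial m u) (^-nonzero (3 ^ℕ m) u≉0)
      (λ y → trans (reflexive (≡.cong (λ d → relTr 1 d (u * y)) (≡.sym n≡1+m))) (Tr[uy]≈0 y)))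
    where
    m = pred n
    n≡1+m : n ≡ suc m
    n≡1+m = ≡.sym (ℕ.suc-pred n {{≢-nonZero n≢0}})
    3ᵐ<3ⁿ : 3 ^ℕ m < 3 ^ℕ n
    3ᵐ<3ⁿ = ℕ.^-monoʳ-< 3 (s≤s (s≤s z≤n)) (≡.subst (m <_) (≡.sym n≡1+m) (ℕ.n<1+n m))

module QuadraticExtension {c ℓ n} (F : GF3 n c ℓ) (m : ℕ) (n≡m+m : n ≡ m +ℕ m) where
  open GF3 F hiding (zero)
  open FiniteField F
  open import Relation.Binary.Reasoning.Setoid setoid
  open import Algebra.Properties.Ring ring using (-1*x≈-x)

  Q : ℕ
  Q = 3 ^ℕ m

  ^Q^Q : ∀ x → (x ^ Q) ^ Q ≈ x
  ^Q^Q x = trans (^-assocʳ x Q Q) (trans (^-congʳ x Q*Q≡3ⁿ) (fermat x))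
    where
    Q*Q≡3ⁿ : Q *ℕ Q ≡ 3 ^ℕ n
    Q*Q≡3ⁿ = ≡.trans (≡.sym (ℕ.^-distribˡ-+-* 3 m m)) (≡.cong (3 ^ℕ_) (≡.sym n≡m+m))

  Trₘ : Carrier → Carrier
  Trₘ = relTr 1 m

  Tr²ᵐₘ : Carrier → Carrier
  Tr²ᵐₘ x = x ^ Q + x

  relTr-2 : ∀ x → relTr m 2 x ≈ Tr²ᵐₘ x
  relTr-2 x = +-cong (^-congʳ x (≡.cong (3 ^ℕ_) (ℕ.+-identityʳ m))) (trans (+-identityʳ _) (*-identityʳ x))

  Tr≈Trₘ∘Tr²ᵐₘ : ∀ x → Tr x ≈ Trₘ (Tr²ᵐₘ x)
  Tr≈Trₘ∘Tr²ᵐₘ x = begin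
    relTr 1 n x                ≡⟨ ≡.cong (λ d → relTr 1 d x) n≡m+m ⟩
    relTr 1 (m +ℕ m) x         ≈⟨ relTr-split m m x ⟩
    Trₘ (x ^ Q) + Trₘ x        ≈⟨ relTr-+ 1 m _ _ ⟨
    Trₘ (Tr²ᵐₘ x)              ∎

  Tr²ᵐₘ-cong : ∀ {x y} → x ≈ y → Tr²ᵐₘ x ≈ Tr²ᵐₘ y
  Tr²ᵐₘ-cong x≈y = +-cong (^-congˡ Q x≈y) x≈y

  Tr²ᵐₘ-− : ∀ x y → Tr²ᵐₘ (x - y) ≈ Tr²ᵐₘ x - Tr²ᵐₘ y
  Tr²ᵐₘ-− x y = trans (+-congʳ (frobenius-− m x y))
    (solve 4 (λ x y xᵠ yᵠ → (xᵠ :- yᵠ) :+ (x :- y) := (xᵠ :+ x) :- (yᵠ :+ y)) refl x y (x ^ Q) (y ^ Q))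

  Tr²ᵐₘ-fixed : ∀ x → Tr²ᵐₘ x ^ Q ≈ Tr²ᵐₘ x
  Tr²ᵐₘ-fixed x = trans (frobenius-+ m (x ^ Q) x) (trans (+-congʳ (^Q^Q x)) (+-comm _ _))

  Tr²ᵐₘ-linear : ∀ {b} x → b ^ Q ≈ b → Tr²ᵐₘ (b * x) ≈ b * Tr²ᵐₘ x
  Tr²ᵐₘ-linear {b} x bᵠ≈b = begin
    (b * x) ^ Q + b * x      ≈⟨ +-congʳ (trans (^-distrib-* b x Q) (*-congʳ bᵠ≈b)) ⟩
    b * x ^ Q + b * x        ≈⟨ distribˡ b _ _ ⟨
    b * (x ^ Q + x)          ∎

  Tr²ᵐₘ-selfAdjoint : ∀ u y → Tr (Tr²ᵐₘ u * y) ≈ Tr (u * Tr²ᵐₘ y)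
  Tr²ᵐₘ-selfAdjoint u y = begin
    Tr (Tr²ᵐₘ u * y)                 ≈⟨ Tr≈Trₘ∘Tr²ᵐₘ _ ⟩
    Trₘ (Tr²ᵐₘ (Tr²ᵐₘ u * y))        ≈⟨ relTr-cong 1 m (Tr²ᵐₘ-linear y (Tr²ᵐₘ-fixed u)) ⟩
    Trₘ (Tr²ᵐₘ u * Tr²ᵐₘ y)          ≈⟨ relTr-cong 1 m (*-comm _ _) ⟩
    Trₘ (Tr²ᵐₘ y * Tr²ᵐₘ u)          ≈⟨ relTr-cong 1 m (Tr²ᵐₘ-linear u (Tr²ᵐₘ-fixed y)) ⟨
    Trₘ (Tr²ᵐₘ (Tr²ᵐₘ y * u))        ≈⟨ Tr≈Trₘ∘Tr²ᵐₘ _ ⟨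
    Tr (Tr²ᵐₘ y * u)                 ≈⟨ relTr-cong 1 n (*-comm _ _) ⟩
    Tr (u * Tr²ᵐₘ y)                 ∎

  -- The projection onto β F_{3^m} along its orthogonal is z ↦ β Tr²ᵐₘ(zβ) / Tr²ᵐₘ(β²).
  scaledSub-supplementary : ∀ {β} → ¬ Tr²ᵐₘ (β * β) ≈ 0# → Supplementary (scaledSub β m) (Perp (scaledSub β m))
  scaledSub-supplementary {β} D≉0 = V∩V⊥≈0 , V+V⊥
    where
    V = scaledSub β m
    D = Tr²ᵐₘ (β * β)

    V∩V⊥≈0 : ∀ z → V z → Perp V z → z ≈ 0#
    V∩V⊥≈0 z (x , xᵠ≈x , z≈βx) z⊥V with x ≟ 0#
    ... | yes x≈0 = trans z≈βx (trans (*-congˡ x≈0) (zeroʳ β))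
    ... | no  x≉0 = ⊥-elim (Tr-nondegenerate T[u]≉0 λ y → begin
          Tr (Tr²ᵐₘ u * y)           ≈⟨ Tr²ᵐₘ-selfAdjoint u y ⟩
          Tr (u * Tr²ᵐₘ y)           ≈⟨ relTr-cong 1 n (solve 4 (λ b x z t → b :* b :* x :* t := b :* x :* (b :* t)) refl β x z (Tr²ᵐₘ y)) ⟩
          Tr (β * x * (β * Tr²ᵐₘ y)) ≈⟨ relTr-cong 1 n (*-congʳ (sym z≈βx)) ⟩
          Tr (z * (β * Tr²ᵐₘ y))     ≈⟨ z⊥V _ (Tr²ᵐₘ y , Tr²ᵐₘ-fixed y , refl) ⟩
          0#                         ∎)
      where
      u = β * β * x
      T[u]≉0 : ¬ Tr²ᵐₘ u ≈ 0#
      T[u]≉0 T[u]≈0 = *-nonzero D≉0 x≉0 (trans (sym (trans (Tr²ᵐₘ-cong (*-comm _ x)) (trans (Tr²ᵐₘ-linear (β * β) xᵠ≈x) (*-comm x D)))) T[u]≈0)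

    V+V⊥ : ∀ z → ∃[ v ] ∃[ y ] (V v × Perp V y × z ≈ v + y)
    V+V⊥ z = β * X , z - β * X , (X , Xᵠ≈X , refl) , z-βX⊥V ,
             solve 2 (λ z v → z := v :+ (z :- v)) refl z (β * X)
      where
      X = Tr²ᵐₘ (z * β) * D ⁻¹
      D⁻¹ᵠ≈D⁻¹ : (D ⁻¹) ^ Q ≈ D ⁻¹
      D⁻¹ᵠ≈D⁻¹ = *-cancelˡ D≉0 (begin
        D * (D ⁻¹) ^ Q        ≈⟨ *-congʳ (Tr²ᵐₘ-fixed (β * β)) ⟨
        D ^ Q * (D ⁻¹) ^ Q    ≈⟨ ^-distrib-* D (D ⁻¹) Q ⟨
        (D * D ⁻¹) ^ Q        ≈⟨ ^-congˡ Q (⁻¹-inv D D≉0) ⟩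
        1# ^ Q                ≈⟨ ^-zeroˡ Q ⟩
        1#                    ≈⟨ ⁻¹-inv D D≉0 ⟨
        D * D ⁻¹              ∎)
      Xᵠ≈X : X ^ Q ≈ X
      Xᵠ≈X = trans (^-distrib-* _ _ Q) (*-cong (Tr²ᵐₘ-fixed (z * β)) D⁻¹ᵠ≈D⁻¹)
      T[Y]≈0 : Tr²ᵐₘ ((z - β * X) * β) ≈ 0#
      T[Y]≈0 = begin
        Tr²ᵐₘ ((z - β * X) * β)               ≈⟨ Tr²ᵐₘ-cong (solve 3 (λ z b x → (z :- b :* x) :* b := z :* b :- x :* (b :* b)) refl z β X) ⟩
        Tr²ᵐₘ (z * β - X * (β * β))           ≈⟨ Tr²ᵐₘ-− _ _ ⟩
        Tr²ᵐₘ (z * β) - Tr²ᵐₘ (X * (β * β))   ≈⟨ +-congˡ (-‿cong (Tr²ᵐₘ-linear (β * β) Xᵠ≈X)) ⟩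
        Tr²ᵐₘ (z * β) - X * D                 ≈⟨ +-congˡ (-‿cong (trans (*-assoc _ _ _) (trans (*-congˡ (x⁻¹*x≈1 D≉0)) (*-identityʳ _)))) ⟩
        Tr²ᵐₘ (z * β) - Tr²ᵐₘ (z * β)         ≈⟨ -‿inverseʳ _ ⟩
        0#                                    ∎
      z-βX⊥V : Perp V (z - β * X)
      z-βX⊥V v (x , xᵠ≈x , v≈βx) = begin
        Tr ((z - β * X) * v)               ≈⟨ relTr-cong 1 n (trans (*-congˡ v≈βx) (sym (*-assoc _ _ _))) ⟩
        Tr ((z - β * X) * β * x)           ≈⟨ Tr≈Trₘ∘Tr²ᵐₘ _ ⟩
        Trₘ (Tr²ᵐₘ ((z - β * X) * β * x))  ≈⟨ relTr-cong 1 m (trans (Tr²ᵐₘ-cong (*-comm _ x)) (Tr²ᵐₘ-linear _ xᵠ≈x)) ⟩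
        Trₘ (x * Tr²ᵐₘ ((z - β * X) * β))  ≈⟨ relTr-cong 1 m (trans (*-congˡ T[Y]≈0) (zeroʳ x)) ⟩
        Trₘ 0#                             ≈⟨ relTr-0 1 m ⟩
        0#                                 ∎

  scaledSub-twisted : ∀ {β w z} → β ^ Q ≈ w * β → scaledSub β m z → z ^ Q ≈ w * z
  scaledSub-twisted {β} {w} {z} βᵠ≈wβ (x , xᵠ≈x , z≈βx) = begin
    z ^ Q          ≈⟨ ^-congˡ Q z≈βx ⟩
    (β * x) ^ Q    ≈⟨ ^-distrib-* β x Q ⟩
    β ^ Q * x ^ Q  ≈⟨ *-cong βᵠ≈wβ xᵠ≈x ⟩
    w * β * x      ≈⟨ *-assoc w β x ⟩
    w * (β * x)    ≈⟨ *-congˡ z≈βx ⟨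
    w * z          ∎

  scaledSub-⊆ : ∀ {β β′ w} → ¬ β′ ≈ 0# → β ^ Q ≈ w * β → β′ ^ Q ≈ w * β′ →
                ∀ z → scaledSub β m z → scaledSub β′ m z
  scaledSub-⊆ {β} {β′} {w} β′≉0 βᵠ≈wβ β′ᵠ≈wβ′ z z∈V = β′ ⁻¹ * z , yᵠ≈y , sym β′y≈z
    where
    β′y≈z : β′ * (β′ ⁻¹ * z) ≈ z
    β′y≈z = trans (sym (*-assoc _ _ _)) (trans (*-congʳ (⁻¹-inv β′ β′≉0)) (*-identityˡ z))
    yᵠ≈y : (β′ ⁻¹ * z) ^ Q ≈ β′ ⁻¹ * z
    yᵠ≈y = *-cancelˡ (^-nonzero Q β′≉0) (begin
      β′ ^ Q * (β′ ⁻¹ * z) ^ Q   ≈⟨ ^-distrib-* β′ _ Q ⟨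
      (β′ * (β′ ⁻¹ * z)) ^ Q     ≈⟨ ^-congˡ Q β′y≈z ⟩
      z ^ Q                      ≈⟨ scaledSub-twisted βᵠ≈wβ z∈V ⟩
      w * z                      ≈⟨ *-congˡ β′y≈z ⟨
      w * (β′ * (β′ ⁻¹ * z))     ≈⟨ *-assoc _ _ _ ⟨
      w * β′ * (β′ ⁻¹ * z)       ≈⟨ *-congʳ β′ᵠ≈wβ′ ⟨
      β′ ^ Q * (β′ ⁻¹ * z)       ∎)

  twisted⇒^[Q-1] : ∀ {w z} → ¬ z ≈ 0# → z ^ Q ≈ w * z → z ^ (Q ∸ 1) ≈ w
  twisted⇒^[Q-1] {w} {z} z≉0 zᵠ≈wz = *-cancelˡ z≉0 (begin
    z * z ^ (Q ∸ 1)  ≈⟨ ^-congʳ z (3^m≡suc m) ⟨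
    z ^ Q            ≈⟨ zᵠ≈wz ⟩
    w * z            ≈⟨ *-comm w z ⟩
    z * w            ∎)

  Tr²ᵐₘ-twisted : ∀ {a w z} j → z ^ Q ≈ w * z → Tr²ᵐₘ (a * z ^ j) ≈ (a ^ Q * w ^ j + a) * z ^ j
  Tr²ᵐₘ-twisted {a} {w} {z} j zᵠ≈wz = begin
    (a * z ^ j) ^ Q + a * z ^ j         ≈⟨ +-congʳ (^-distrib-* a (z ^ j) Q) ⟩
    a ^ Q * (z ^ j) ^ Q + a * z ^ j     ≈⟨ +-congʳ (*-congˡ (trans (^-comm z j Q) (^-congˡ j zᵠ≈wz))) ⟩
    a ^ Q * (w * z) ^ j + a * z ^ j     ≈⟨ +-congʳ (*-congˡ (^-distrib-* w z j)) ⟩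
    a ^ Q * (w ^ j * z ^ j) + a * z ^ j ≈⟨ solve 4 (λ x y u a → x :* (y :* u) :+ a :* u := (x :* y :+ a) :* u) refl (a ^ Q) (w ^ j) (z ^ j) a ⟩
    (a ^ Q * w ^ j + a) * z ^ j         ∎

  twisted-relTr≈0 : ∀ {a w z} j → z ^ Q ≈ w * z → a ^ Q * w ^ j ≈ - a → relTr m 2 (a * z ^ j) ≈ 0#
  twisted-relTr≈0 {a} {w} {z} j zᵠ≈wz aᵠwʲ≈-a = begin
    relTr m 2 (a * z ^ j)         ≈⟨ relTr-2 _ ⟩
    Tr²ᵐₘ (a * z ^ j)             ≈⟨ Tr²ᵐₘ-twisted j zᵠ≈wz ⟩
    (a ^ Q * w ^ j + a) * z ^ j   ≈⟨ *-congʳ (trans (+-congʳ aᵠwʲ≈-a) (-‿inverseˡ a)) ⟩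
    0# * z ^ j                    ≈⟨ zeroˡ _ ⟩
    0#                            ∎

  relTr≈0⇒twisted : ∀ {a w z} j → ¬ z ≈ 0# → z ^ Q ≈ w * z → relTr m 2 (a * z ^ j) ≈ 0# → a ^ Q * w ^ j ≈ - a
  relTr≈0⇒twisted {a} {w} {z} j z≉0 zᵠ≈wz relTr≈0
    with zero-product (trans (sym (Tr²ᵐₘ-twisted j zᵠ≈wz)) (trans (sym (relTr-2 _)) relTr≈0))
  ... | inj₁ aᵠwʲ+a≈0 = x+y≈0⇒x≈-y aᵠwʲ+a≈0
  ... | inj₂ zʲ≈0     = ⊥-elim (^-nonzero j z≉0 zʲ≈0)

  twisted⇒0∨^[Q-1] : ∀ {w z} → z ^ Q ≈ w * z → z ≈ 0# ⊎ z ^ (Q ∸ 1) ≈ w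
  twisted⇒0∨^[Q-1] {z = z} zᵠ≈wz with z ≟ 0#
  ... | yes z≈0 = inj₁ z≈0
  ... | no  z≉0 = inj₂ (twisted⇒^[Q-1] z≉0 zᵠ≈wz)

  -- Hilbert 90: w of norm w ^ (Q + 1) = 1 is β ^ (Q - 1) for β = 1 + w ^ Q, except when
  -- w = -1, where b serves.
  hilbert90 : ∀ {b w} → ¬ b ≈ 0# → b ^ Q ≈ - b → w ^ Q * w ≈ 1# → ∃[ β ] (¬ β ≈ 0# × β ^ Q ≈ w * β)
  hilbert90 {b} {w} b≉0 bᵠ≈-b N[w]≈1 with w ≟ (- 1#)
  ... | yes w≈-1 = b , b≉0 , trans bᵠ≈-b (trans (sym (-1*x≈-x b)) (*-congʳ (sym w≈-1)))
  ... | no  w≉-1 = 1# + w ^ Q , 1+wᵠ≉0 , (begin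
      (1# + w ^ Q) ^ Q        ≈⟨ frobenius-+ m 1# (w ^ Q) ⟩
      1# ^ Q + (w ^ Q) ^ Q    ≈⟨ +-cong (^-zeroˡ Q) (^Q^Q w) ⟩
      1# + w                  ≈⟨ +-congʳ N[w]≈1 ⟨
      w ^ Q * w + w           ≈⟨ solve 2 (λ w wᵠ → wᵠ :* w :+ w := w :* (con 1₃ :+ wᵠ)) refl w (w ^ Q) ⟩
      w * (1# + w ^ Q)        ∎)
    where
    1+wᵠ≉0 : ¬ 1# + w ^ Q ≈ 0#
    1+wᵠ≉0 1+wᵠ≈0 = w≉-1 (begin
      w                          ≈⟨ solve 2 (λ w wᵠ → w := w :* (con 1₃ :+ wᵠ) :- wᵠ :* w) refl w (w ^ Q) ⟩
      w * (1# + w ^ Q) - w ^ Q * w ≈⟨ +-cong (trans (*-congˡ 1+wᵠ≈0) (zeroʳ w)) (-‿cong N[w]≈1) ⟩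
      0# - 1#                    ≈⟨ +-identityˡ _ ⟩
      - 1#                       ∎)

⌊3^_/2⌋ : ℕ → ℕ
⌊3^ zero  /2⌋ = 0
⌊3^ suc k /2⌋ = suc (3 *ℕ ⌊3^ k /2⌋)

3^≡1+2⌊3^/2⌋ : ∀ k → 3 ^ℕ k ≡ suc (2 *ℕ ⌊3^ k /2⌋)
3^≡1+2⌊3^/2⌋ zero    = ≡.refl
3^≡1+2⌊3^/2⌋ (suc k) = ≡.trans (≡.cong (3 *ℕ_) (3^≡1+2⌊3^/2⌋ k)) (lemma ⌊3^ k /2⌋)
  where
  lemma : ∀ y → 3 *ℕ suc (2 *ℕ y) ≡ suc (2 *ℕ suc (3 *ℕ y))
  lemma = solve-∀

-- Writing 3ᵏ = 2y + 1, the exponents of the construction are polynomials in y,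
-- with 3²ᵏ = 4r + 1 and 3⁴ᵏ = 2h + 1.
module Exponents where
  [1+2y]²≡1+4r : ∀ y → let r = y *ℕ suc y in suc (2 *ℕ y) *ℕ suc (2 *ℕ y) ≡ suc (4 *ℕ r)
  [1+2y]²≡1+4r = solve-∀

  [1+4r]²≡1+2h : ∀ y → let r = y *ℕ suc y; h = 4 *ℕ r *ℕ suc (2 *ℕ r) in
                 suc (4 *ℕ r) *ℕ suc (4 *ℕ r) ≡ suc (h +ℕ h)
  [1+4r]²≡1+2h = solve-∀

  [q-1][Q+1]≡4e : ∀ y → let r = y *ℕ suc y in 2 *ℕ y *ℕ (suc (4 *ℕ r) +ℕ 1) ≡ y *ℕ suc (2 *ℕ r) *ℕ 4
  [q-1][Q+1]≡4e = solve-∀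

  q+1≡2[y+1] : ∀ y → suc (2 *ℕ y) +ℕ 1 ≡ suc y *ℕ 2
  q+1≡2[y+1] = solve-∀

  4re≡hy : ∀ y → let r = y *ℕ suc y; h = 4 *ℕ r *ℕ suc (2 *ℕ r) in
           y *ℕ suc (2 *ℕ r) *ℕ (4 *ℕ r) ≡ h *ℕ y
  4re≡hy = solve-∀

  norm-exponent : ∀ y → let r = y *ℕ suc y; h = 4 *ℕ r *ℕ suc (2 *ℕ r) in
                  y *ℕ (2 *ℕ r) *ℕ 2 *ℕ suc (2 *ℕ r) ≡ h *ℕ y
  norm-exponent = solve-∀

  a₂-trace-exponent : ∀ y → let r = y *ℕ suc y; h = 4 *ℕ r *ℕ suc (2 *ℕ r) in
                      suc y *ℕ (4 *ℕ r) +ℕ y *ℕ (2 *ℕ r) *ℕ 2 *ℕ suc (2 *ℕ y) ≡ h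
  a₂-trace-exponent = solve-∀

  a₁-trace-exponent : ∀ y → let r = y *ℕ suc y; h = 4 *ℕ r *ℕ suc (2 *ℕ r) in
                      4 *ℕ r +ℕ y *ℕ (2 *ℕ r) *ℕ 2 *ℕ (2 *ℕ suc y) ≡ h
  a₁-trace-exponent = solve-∀

  4e[y+1]≡h : ∀ y → let r = y *ℕ suc y; h = 4 *ℕ r *ℕ suc (2 *ℕ r) in
              y *ℕ suc (2 *ℕ r) *ℕ 2 *ℕ (2 *ℕ suc y) ≡ h
  4e[y+1]≡h = solve-∀

  [1+2r]4r≡h : ∀ y → let r = y *ℕ suc y; h = 4 *ℕ r *ℕ suc (2 *ℕ r) in
               suc (2 *ℕ r) *ℕ (4 *ℕ r) ≡ h
  [1+2r]4r≡h = solve-∀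

  1+[1+4r]≡2[1+2r] : ∀ y → let r = y *ℕ suc y in suc (suc (4 *ℕ r)) ≡ 2 *ℕ suc (2 *ℕ r)
  1+[1+4r]≡2[1+2r] = solve-∀

  4k≡2k+2k : ∀ k → 4 *ℕ k ≡ 2 *ℕ k +ℕ 2 *ℕ k
  4k≡2k+2k = solve-∀

  2k≡k+k : ∀ k → 2 *ℕ k ≡ k +ℕ k
  2k≡k+k = solve-∀

module Construction {c ℓ} (k : ℕ) (k≥1 : 1 ≤ k) (F : GF3 (4 *ℕ k) c ℓ) where
  open GF3 F hiding (zero)
  open FiniteField F
  open QuadraticExtension F (2 *ℕ k) (Exponents.4k≡2k+2k k)
  open import Relation.Binary.Reasoning.Setoid setoid
  open Exponents

  q y r h ρ : ℕ
  q = 3 ^ℕ k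
  y = ⌊3^ k /2⌋
  r = y *ℕ suc y
  h = 4 *ℕ r *ℕ suc (2 *ℕ r)
  ρ = y *ℕ (2 *ℕ r)

  q≡1+2y : q ≡ suc (2 *ℕ y)
  q≡1+2y = 3^≡1+2⌊3^/2⌋ k

  q*q≡Q : q *ℕ q ≡ Q
  q*q≡Q = ≡.trans (≡.sym (ℕ.^-distribˡ-+-* 3 k k)) (≡.cong (3 ^ℕ_) (≡.sym (2k≡k+k k)))

  Q≡1+4r : Q ≡ suc (4 *ℕ r)
  Q≡1+4r = ≡.trans (≡.sym q*q≡Q) (≡.trans (≡.cong₂ _*ℕ_ q≡1+2y q≡1+2y) ([1+2y]²≡1+4r y))

  3ⁿ≡1+2h : 3 ^ℕ (4 *ℕ k) ≡ suc (h +ℕ h)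
  3ⁿ≡1+2h = ≡.trans (≡.cong (3 ^ℕ_) (4k≡2k+2k k)) (≡.trans (ℕ.^-distribˡ-+-* 3 (2 *ℕ k) (2 *ℕ k))
              (≡.trans (≡.cong₂ _*ℕ_ Q≡1+4r Q≡1+4r) ([1+4r]²≡1+2h y)))

  xᵠ≈x*x^4r : ∀ x → x ^ Q ≈ x * x ^ (4 *ℕ r)
  xᵠ≈x*x^4r x = ^-congʳ x Q≡1+4r

  [x^j]ᵠ : ∀ x j → (x ^ j) ^ Q ≈ x ^ j * x ^ (j *ℕ (4 *ℕ r))
  [x^j]ᵠ x j = trans (xᵠ≈x*x^4r (x ^ j)) (*-congˡ (^-assocʳ x j (4 *ℕ r)))

  -1ᵠ≈-1 : (- 1#) ^ Q ≈ - 1#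
  -1ᵠ≈-1 = trans (frobenius-neg (2 *ℕ k) 1#) (-‿cong (^-zeroˡ Q))

  m : Carrier
  m = (- 1#) ^ k

  m*m≈1 : m * m ≈ 1#
  m*m≈1 = trans (sym (^-distrib-* (- 1#) (- 1#) k)) (trans (^-congˡ k -1*-1≈1) (^-zeroˡ k))

  mᵠ≈m : m ^ Q ≈ m
  mᵠ≈m = trans (^-comm (- 1#) k Q) (^-congˡ k -1ᵠ≈-1)

  [-1]^⌊3^j/2⌋≈[-1]^j : ∀ j → (- 1#) ^ ⌊3^ j /2⌋ ≈ (- 1#) ^ j
  [-1]^⌊3^j/2⌋≈[-1]^j zero    = refl
  [-1]^⌊3^j/2⌋≈[-1]^j (suc j) = *-congˡ (begin
    (- 1#) ^ (3 *ℕ ⌊3^ j /2⌋)    ≈⟨ ^-assocʳ (- 1#) 3 ⌊3^ j /2⌋ ⟨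
    ((- 1#) ^ 3) ^ ⌊3^ j /2⌋     ≈⟨ ^-congˡ ⌊3^ j /2⌋ (x*x≈1⇒x^odd≈x 1 -1*-1≈1) ⟩
    (- 1#) ^ ⌊3^ j /2⌋           ≈⟨ [-1]^⌊3^j/2⌋≈[-1]^j j ⟩
    (- 1#) ^ j                   ∎)

  x^[hy]≈m : ∀ {x} → x ^ h ≈ - 1# → x ^ (h *ℕ y) ≈ m
  x^[hy]≈m {x} xʰ≈-1 = trans (sym (^-assocʳ x h y)) (trans (^-congˡ y xʰ≈-1) ([-1]^⌊3^j/2⌋≈[-1]^j k))

  module Solution (a₁ I σ : Carrier) (a₁-nonsquare : NonSquare a₁) (I-primitive : Primitive4thRoot I)
                  (σ≈±1 : σ ≈ 1# ⊎ σ ≈ - 1#) where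

    a₁≉0 : ¬ a₁ ≈ 0#
    a₁≉0 = nonsquare-nonzero a₁-nonsquare

    a₁ʰ≈-1 : a₁ ^ h ≈ - 1#
    a₁ʰ≈-1 = euler-criterion h 3ⁿ≡1+2h a₁-nonsquare

    a₁⁻¹ʰ≈-1 : (a₁ ⁻¹) ^ h ≈ - 1#
    a₁⁻¹ʰ≈-1 = begin
      (a₁ ⁻¹) ^ h                     ≈⟨ solve 1 (λ x → x := :- (x :* :- con 1₃)) refl _ ⟩
      - ((a₁ ⁻¹) ^ h * - 1#)          ≈⟨ -‿cong (*-congˡ a₁ʰ≈-1) ⟨
      - ((a₁ ⁻¹) ^ h * a₁ ^ h)        ≈⟨ -‿cong (^-distrib-* (a₁ ⁻¹) a₁ h) ⟨
      - ((a₁ ⁻¹ * a₁) ^ h)            ≈⟨ -‿cong (trans (^-congˡ h (x⁻¹*x≈1 a₁≉0)) (^-zeroˡ h)) ⟩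
      - 1#                            ∎

    I*I≈-1 : I * I ≈ - 1#
    I*I≈-1 with x*x≈1⇒x≈±1 (trans (solve 1 (λ i → (i :* i) :* (i :* i) := i :* (i :* (i :* (i :* con 1₃)))) refl I) (proj₁ I-primitive))
    ... | inj₁ I*I≈1  = ⊥-elim (proj₁ (proj₂ (proj₂ I-primitive)) (trans (x^2≈x*x I) I*I≈1))
    ... | inj₂ I*I≈-1 = I*I≈-1

    Iᵠ≈I : I ^ Q ≈ I
    Iᵠ≈I = begin
      I ^ Q              ≈⟨ xᵠ≈x*x^4r I ⟩
      I * I ^ (4 *ℕ r)   ≈⟨ *-congˡ (^-assocʳ I 4 r) ⟨
      I * (I ^ 4) ^ r    ≈⟨ *-congˡ (trans (^-congˡ r (proj₁ I-primitive)) (^-zeroˡ r)) ⟩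
      I * 1#             ≈⟨ *-identityʳ I ⟩
      I                  ∎

    σ*σ≈1 : σ * σ ≈ 1#
    σ*σ≈1 = [ (λ σ≈1 → trans (*-cong σ≈1 σ≈1) (*-identityˡ 1#)) , (λ σ≈-1 → trans (*-cong σ≈-1 σ≈-1) -1*-1≈1) ]′ σ≈±1

    σᵠ≈σ : σ ^ Q ≈ σ
    σᵠ≈σ = [ (λ σ≈1 → trans (^-congˡ Q σ≈1) (trans (^-zeroˡ Q) (sym σ≈1))) , (λ σ≈-1 → trans (^-congˡ Q σ≈-1) (trans -1ᵠ≈-1 (sym σ≈-1))) ]′ σ≈±1

    e : ℕ
    e = y *ℕ suc (2 *ℕ r)

    s s⁻¹ t : Carrier
    s = a₁ ^ e
    s⁻¹ = (a₁ ⁻¹) ^ e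
    t = m * s + s⁻¹

    s⁻¹*s≈1 : s⁻¹ * s ≈ 1#
    s⁻¹*s≈1 = trans (sym (^-distrib-* (a₁ ⁻¹) a₁ e)) (trans (^-congˡ e (x⁻¹*x≈1 a₁≉0)) (^-zeroˡ e))

    [x^e]ᵠ : ∀ {x} → x ^ h ≈ - 1# → (x ^ e) ^ Q ≈ m * x ^ e
    [x^e]ᵠ {x} xʰ≈-1 = begin
      (x ^ e) ^ Q                ≈⟨ [x^j]ᵠ x e ⟩
      x ^ e * x ^ (e *ℕ (4 *ℕ r)) ≈⟨ *-congˡ (^-congʳ x (4re≡hy y)) ⟩
      x ^ e * x ^ (h *ℕ y)        ≈⟨ *-congˡ (x^[hy]≈m xʰ≈-1) ⟩
      x ^ e * m                   ≈⟨ *-comm _ _ ⟩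
      m * x ^ e                   ∎

    tᵠ≈mt : t ^ Q ≈ m * t
    tᵠ≈mt = begin
      (m * s + s⁻¹) ^ Q           ≈⟨ frobenius-+ (2 *ℕ k) (m * s) s⁻¹ ⟩
      (m * s) ^ Q + s⁻¹ ^ Q       ≈⟨ +-congʳ (^-distrib-* m s Q) ⟩
      m ^ Q * s ^ Q + s⁻¹ ^ Q     ≈⟨ +-cong (*-cong mᵠ≈m ([x^e]ᵠ a₁ʰ≈-1)) ([x^e]ᵠ a₁⁻¹ʰ≈-1) ⟩
      m * (m * s) + m * s⁻¹       ≈⟨ distribˡ m _ _ ⟨
      m * t                       ∎

    a₂ : Carrier
    a₂ = σ * (I ^ k) * (a₁ ^ ((q +ℕ 1) / 2)) * (((- 1#) ^ k) * (a₁ ^ (((q ∸ 1) *ℕ (Q +ℕ 1)) / 4)) + ((a₁ ⁻¹) ^ (((q ∸ 1) *ℕ (Q +ℕ 1)) / 4)))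

    a₂≈σIᵏa₁^[1+y]t : a₂ ≈ σ * I ^ k * a₁ ^ suc y * t
    a₂≈σIᵏa₁^[1+y]t = *-cong (*-congˡ (^-congʳ a₁ [q+1]/2≡1+y)) (+-cong (*-congˡ (^-congʳ a₁ e≡)) (^-congʳ (a₁ ⁻¹) e≡))
      where
      [q+1]/2≡1+y : (q +ℕ 1) / 2 ≡ suc y
      [q+1]/2≡1+y = ≡.trans (≡.cong (λ x → (x +ℕ 1) / 2) q≡1+2y) (≡.trans (≡.cong (_/ 2) (q+1≡2[y+1] y)) (m*n/n≡m (suc y) 2))
      e≡ : ((q ∸ 1) *ℕ (Q +ℕ 1)) / 4 ≡ e
      e≡ = ≡.trans (≡.cong₂ (λ a b → ((a ∸ 1) *ℕ (b +ℕ 1)) / 4) q≡1+2y Q≡1+4r)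
                   (≡.trans (≡.cong (_/ 4) ([q-1][Q+1]≡4e y)) (m*n/n≡m e 4))

    P R γ w : Carrier
    P = a₁ ^ y
    R = a₁ ^ ρ
    γ = - (σ * (- I) ^ k)
    w = γ * R

    s≈PR : s ≈ P * R
    s≈PR = trans (^-congʳ a₁ (ℕ.*-suc y (2 *ℕ r))) (^-homo-* a₁ y ρ)

    γ*γ≈m : γ * γ ≈ m
    γ*γ≈m = begin
      γ * γ                                ≈⟨ solve 2 (λ a b → (:- (a :* b)) :* (:- (a :* b)) := (a :* a) :* (b :* b)) refl σ ((- I) ^ k) ⟩
      (σ * σ) * ((- I) ^ k * (- I) ^ k)    ≈⟨ *-cong σ*σ≈1 (sym (^-distrib-* (- I) (- I) k)) ⟩
      1# * ((- I) * (- I)) ^ k             ≈⟨ *-identityˡ _ ⟩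
      ((- I) * (- I)) ^ k                  ≈⟨ ^-congˡ k (trans (solve 1 (λ i → (:- i) :* (:- i) := i :* i) refl I) I*I≈-1) ⟩
      m                                    ∎

    σIᵏγ≈-1 : σ * I ^ k * γ ≈ - 1#
    σIᵏγ≈-1 = begin
      σ * I ^ k * γ                       ≈⟨ solve 3 (λ a b d → a :* b :* (:- (a :* d)) := :- ((a :* a) :* (b :* d))) refl σ (I ^ k) ((- I) ^ k) ⟩
      - ((σ * σ) * (I ^ k * (- I) ^ k))   ≈⟨ -‿cong (*-cong σ*σ≈1 (sym (^-distrib-* I (- I) k))) ⟩
      - (1# * (I * - I) ^ k)              ≈⟨ -‿cong (*-identityˡ _) ⟩
      - ((I * - I) ^ k)                   ≈⟨ -‿cong (^-congˡ k I*-I≈1) ⟩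
      - (1# ^ k)                          ≈⟨ -‿cong (^-zeroˡ k) ⟩
      - 1#                                ∎
      where
      I*-I≈1 : I * - I ≈ 1#
      I*-I≈1 = trans (solve 1 (λ i → i :* (:- i) := :- con 1₃ :* (i :* i)) refl I) (trans (*-congˡ I*I≈-1) -1*-1≈1)

    w*w≈m[R*R] : w * w ≈ m * (R * R)
    w*w≈m[R*R] = trans (solve 2 (λ g x → (g :* x) :* (g :* x) := (g :* g) :* (x :* x)) refl γ R) (*-congʳ γ*γ≈m)

    [w*w]^j : ∀ j → (w * w) ^ j ≈ m ^ j * a₁ ^ (ρ *ℕ 2 *ℕ j)
    [w*w]^j j = begin
      (w * w) ^ j                             ≈⟨ ^-congˡ j w*w≈m[R*R] ⟩
      (m * (R * R)) ^ j                       ≈⟨ ^-distrib-* m (R * R) j ⟩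
      m ^ j * (R * R) ^ j                     ≈⟨ *-congˡ (^-congˡ j (sym (x^2≈x*x R))) ⟩
      m ^ j * (R ^ 2) ^ j                     ≈⟨ *-congˡ (^-congˡ j (^-assocʳ a₁ ρ 2)) ⟩
      m ^ j * (a₁ ^ (ρ *ℕ 2)) ^ j             ≈⟨ *-congˡ (^-assocʳ a₁ (ρ *ℕ 2) j) ⟩
      m ^ j * a₁ ^ (ρ *ℕ 2 *ℕ j)              ∎

    wᵠ*w≈[w*w]^[1+2r] : w ^ Q * w ≈ (w * w) ^ suc (2 *ℕ r)
    wᵠ*w≈[w*w]^[1+2r] = begin
      w ^ Q * w                ≈⟨ *-comm _ _ ⟩
      w ^ suc Q                ≈⟨ ^-congʳ w (≡.trans (≡.cong suc Q≡1+4r) (1+[1+4r]≡2[1+2r] y)) ⟩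
      w ^ (2 *ℕ suc (2 *ℕ r))  ≈⟨ x^[2j]≈[x*x]^j w (suc (2 *ℕ r)) ⟩
      (w * w) ^ suc (2 *ℕ r)   ∎

    wᵠ*w≈1 : w ^ Q * w ≈ 1#
    wᵠ*w≈1 = begin
      w ^ Q * w                ≈⟨ trans wᵠ*w≈[w*w]^[1+2r] ([w*w]^j (suc (2 *ℕ r))) ⟩
      m ^ suc (2 *ℕ r) * a₁ ^ (ρ *ℕ 2 *ℕ suc (2 *ℕ r))  ≈⟨ *-cong (x*x≈1⇒x^odd≈x r m*m≈1) (^-congʳ a₁ (norm-exponent y)) ⟩
      m * a₁ ^ (h *ℕ y)        ≈⟨ *-congˡ (x^[hy]≈m a₁ʰ≈-1) ⟩
      m * m                    ≈⟨ m*m≈1 ⟩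
      1#                       ∎

    w≉0 : ¬ w ≈ 0#
    w≉0 w≈0 = 1≉0 (trans (sym wᵠ*w≈1) (trans (*-congˡ w≈0) (zeroʳ _)))

    1+w*w≉0 : ¬ 1# + w * w ≈ 0#
    1+w*w≉0 1+w²≈0 = 1≉-1 (begin
      1#                        ≈⟨ wᵠ*w≈1 ⟨
      w ^ Q * w                 ≈⟨ wᵠ*w≈[w*w]^[1+2r] ⟩
      (w * w) ^ suc (2 *ℕ r)    ≈⟨ ^-congˡ (suc (2 *ℕ r)) (x+y≈0⇒y≈-x 1+w²≈0) ⟩
      (- 1#) ^ suc (2 *ℕ r)     ≈⟨ x*x≈1⇒x^odd≈x r -1*-1≈1 ⟩
      - 1#                      ∎)

    a₁^q≈a₁PP : a₁ ^ q ≈ a₁ * (P * P)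
    a₁^q≈a₁PP = trans (^-congʳ a₁ q≡1+2y) (*-congˡ (trans (x^[2j]≈[x*x]^j a₁ y) (^-distrib-* a₁ a₁ y)))

    quadratic : a₁ + a₁ ^ q * (w * w) + a₂ * w ≈ 0#
    quadratic = begin
      a₁ + a₁ ^ q * (w * w) + a₂ * w
        ≈⟨ +-cong (+-congˡ (*-cong a₁^q≈a₁PP w*w≈m[R*R])) (*-congʳ a₂≈σIᵏa₁^[1+y]t) ⟩
      a₁ + a₁ * (P * P) * (m * (R * R)) + σ * I ^ k * (a₁ * P) * t * (γ * R)
        ≈⟨ solve 8 (λ a p x m σ i g t → a :+ a :* (p :* p) :* (m :* (x :* x)) :+ σ :* i :* (a :* p) :* t :* (g :* x)
                                      := a :+ m :* a :* (p :* x) :* (p :* x) :+ (σ :* i :* g) :* (a :* (p :* x) :* t))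
                 refl a₁ P R m σ (I ^ k) γ t ⟩
      a₁ + m * a₁ * (P * R) * (P * R) + (σ * I ^ k * γ) * (a₁ * (P * R) * t)
        ≈⟨ +-cong (+-congˡ (*-cong (*-congˡ (sym s≈PR)) (sym s≈PR))) (*-cong σIᵏγ≈-1 (*-congʳ (*-congˡ (sym s≈PR)))) ⟩
      a₁ + m * a₁ * s * s + - 1# * (a₁ * s * (m * s + s⁻¹))
        ≈⟨ solve 4 (λ a m s u → a :+ m :* a :* s :* s :+ (:- con 1₃) :* (a :* s :* (m :* s :+ u)) := a :- a :* (u :* s)) refl a₁ m s s⁻¹ ⟩
      a₁ - a₁ * (s⁻¹ * s)
        ≈⟨ +-congˡ (-‿cong (trans (*-congˡ s⁻¹*s≈1) (*-identityʳ a₁))) ⟩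
      a₁ - a₁
        ≈⟨ -‿inverseʳ a₁ ⟩
      0# ∎

    a₂ᵠ : a₂ ^ Q ≈ a₂ * (m * a₁ ^ (suc y *ℕ (4 *ℕ r)))
    a₂ᵠ = begin
      a₂ ^ Q
        ≈⟨ ^-congˡ Q a₂≈σIᵏa₁^[1+y]t ⟩
      (σ * I ^ k * a₁ ^ suc y * t) ^ Q
        ≈⟨ trans (^-distrib-* _ t Q) (*-congʳ (trans (^-distrib-* _ (a₁ ^ suc y) Q) (*-congʳ (^-distrib-* σ (I ^ k) Q)))) ⟩
      σ ^ Q * (I ^ k) ^ Q * (a₁ ^ suc y) ^ Q * t ^ Q
        ≈⟨ *-cong (*-cong (*-cong σᵠ≈σ (trans (^-comm I k Q) (^-congˡ k Iᵠ≈I))) ([x^j]ᵠ a₁ (suc y))) tᵠ≈mt ⟩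
      σ * I ^ k * (a₁ ^ suc y * a₁ ^ (suc y *ℕ (4 *ℕ r))) * (m * t)
        ≈⟨ solve 6 (λ a b c d e f → a :* b :* (c :* d) :* (e :* f) := a :* b :* c :* f :* (e :* d)) refl σ (I ^ k) (a₁ ^ suc y) _ m t ⟩
      σ * I ^ k * a₁ ^ suc y * t * (m * a₁ ^ (suc y *ℕ (4 *ℕ r)))
        ≈⟨ *-congʳ a₂≈σIᵏa₁^[1+y]t ⟨
      a₂ * (m * a₁ ^ (suc y *ℕ (4 *ℕ r)))
        ∎

    a₂-trace : a₂ ^ Q * w ^ (2 *ℕ q) ≈ - a₂
    a₂-trace = begin
      a₂ ^ Q * w ^ (2 *ℕ q)
        ≈⟨ *-cong a₂ᵠ (trans (x^[2j]≈[x*x]^j w q) (trans ([w*w]^j q) (*-congʳ (^-congʳ m q≡1+2y)))) ⟩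
      a₂ * (m * a₁ ^ (suc y *ℕ (4 *ℕ r))) * (m ^ suc (2 *ℕ y) * a₁ ^ (ρ *ℕ 2 *ℕ q))
        ≈⟨ *-congˡ (*-congˡ (^-congʳ a₁ (≡.cong (ρ *ℕ 2 *ℕ_) q≡1+2y))) ⟩
      a₂ * (m * a₁ ^ (suc y *ℕ (4 *ℕ r))) * (m ^ suc (2 *ℕ y) * a₁ ^ (ρ *ℕ 2 *ℕ suc (2 *ℕ y)))
        ≈⟨ *-congˡ (*-congʳ (x*x≈1⇒x^odd≈x y m*m≈1)) ⟩
      a₂ * (m * a₁ ^ (suc y *ℕ (4 *ℕ r))) * (m * a₁ ^ (ρ *ℕ 2 *ℕ suc (2 *ℕ y)))
        ≈⟨ solve 4 (λ a m x z → a :* (m :* x) :* (m :* z) := a :* (m :* m) :* (x :* z)) refl a₂ m _ _ ⟩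
      a₂ * (m * m) * (a₁ ^ (suc y *ℕ (4 *ℕ r)) * a₁ ^ (ρ *ℕ 2 *ℕ suc (2 *ℕ y)))
        ≈⟨ *-cong (trans (*-congˡ m*m≈1) (*-identityʳ a₂)) (trans (sym (^-homo-* a₁ (suc y *ℕ (4 *ℕ r)) (ρ *ℕ 2 *ℕ suc (2 *ℕ y)))) (^-congʳ a₁ (a₂-trace-exponent y))) ⟩
      a₂ * a₁ ^ h
        ≈⟨ *-congˡ a₁ʰ≈-1 ⟩
      a₂ * - 1#
        ≈⟨ solve 1 (λ a → a :* (:- con 1₃) := :- a) refl a₂ ⟩
      - a₂
        ∎

    q+1≡2[1+y] : q +ℕ 1 ≡ 2 *ℕ suc y
    q+1≡2[1+y] = ≡.trans (≡.cong (_+ℕ 1) q≡1+2y) (≡.trans (q+1≡2[y+1] y) (ℕ.*-comm (suc y) 2))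

    a₁-trace : a₁ ^ Q * w ^ (2 *ℕ (q +ℕ 1)) ≈ - a₁
    a₁-trace = begin
      a₁ ^ Q * w ^ (2 *ℕ (q +ℕ 1))
        ≈⟨ *-cong (xᵠ≈x*x^4r a₁) (trans (x^[2j]≈[x*x]^j w (q +ℕ 1)) (trans (^-congʳ (w * w) q+1≡2[1+y]) ([w*w]^j (2 *ℕ suc y)))) ⟩
      a₁ * a₁ ^ (4 *ℕ r) * (m ^ (2 *ℕ suc y) * a₁ ^ (ρ *ℕ 2 *ℕ (2 *ℕ suc y)))
        ≈⟨ *-congˡ (trans (*-congʳ (x*x≈1⇒x^even≈1 (suc y) m*m≈1)) (*-identityˡ _)) ⟩
      a₁ * a₁ ^ (4 *ℕ r) * a₁ ^ (ρ *ℕ 2 *ℕ (2 *ℕ suc y))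
        ≈⟨ trans (*-assoc _ _ _) (*-congˡ (trans (sym (^-homo-* a₁ (4 *ℕ r) (ρ *ℕ 2 *ℕ (2 *ℕ suc y)))) (^-congʳ a₁ (a₁-trace-exponent y)))) ⟩
      a₁ * a₁ ^ h
        ≈⟨ *-congˡ a₁ʰ≈-1 ⟩
      a₁ * - 1#
        ≈⟨ solve 1 (λ a → a :* (:- con 1₃) := :- a) refl a₁ ⟩
      - a₁
        ∎

    quadraticᵠ : a₁ ^ q + a₁ ^ Q * (w * w) ^ q + a₂ ^ q * w ^ q ≈ 0#
    quadraticᵠ = begin
      a₁ ^ q + a₁ ^ Q * (w * w) ^ q + a₂ ^ q * w ^ q          ≈⟨ +-congʳ (+-congˡ (*-congʳ (trans (^-assocʳ a₁ q q) (^-congʳ a₁ q*q≡Q)))) ⟨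
      a₁ ^ q + (a₁ ^ q) ^ q * (w * w) ^ q + a₂ ^ q * w ^ q    ≈⟨ +-cong (+-congˡ (^-distrib-* (a₁ ^ q) (w * w) q)) (^-distrib-* a₂ w q) ⟨
      a₁ ^ q + (a₁ ^ q * (w * w)) ^ q + (a₂ * w) ^ q          ≈⟨ +-congʳ (frobenius-+ k a₁ (a₁ ^ q * (w * w))) ⟨
      (a₁ + a₁ ^ q * (w * w)) ^ q + (a₂ * w) ^ q              ≈⟨ frobenius-+ k _ (a₂ * w) ⟨
      (a₁ + a₁ ^ q * (w * w) + a₂ * w) ^ q                    ≈⟨ ^-congˡ q quadratic ⟩
      0# ^ q                                                  ≈⟨ 0^3^m≈0 k ⟩
      0#                                                      ∎

    -- Multiplied by w, the second equation is w² times the Frobenius image of the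
    -- quadratic, plus the quadratic, minus the vanishing a₁-trace; 2 = -1 makes it match.
    second-equation : - (a₁ ^ q * w) + a₂ + a₂ ^ q * w ^ (q +ℕ 1) ≈ 0#
    second-equation = *-cancelˡ w≉0 (begin
      w * (- (a₁ ^ q * w) + a₂ + a₂ ^ q * w ^ (q +ℕ 1))
        ≈⟨ *-congˡ (+-congˡ (*-congˡ (^-congʳ w (ℕ.+-comm q 1)))) ⟩
      w * (- (a₁ ^ q * w) + a₂ + a₂ ^ q * (w * w ^ q))
        ≈⟨ solve 8 (λ w aq aQ a aq′ U V A →
                w :* (:- (aq :* w) :+ a :+ aq′ :* (w :* V))
             := (w :* w) :* (aq :+ aQ :* U :+ aq′ :* V) :+ (A :+ aq :* (w :* w) :+ a :* w) :- (aQ :* ((w :* w) :* U) :+ A))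
             refl w (a₁ ^ q) (a₁ ^ Q) a₂ (a₂ ^ q) ((w * w) ^ q) (w ^ q) a₁ ⟩
      (w * w) * (a₁ ^ q + a₁ ^ Q * (w * w) ^ q + a₂ ^ q * w ^ q) + (a₁ + a₁ ^ q * (w * w) + a₂ * w)
        - (a₁ ^ Q * ((w * w) * (w * w) ^ q) + a₁)
        ≈⟨ +-cong (+-cong (*-congˡ quadraticᵠ) quadratic) (-‿cong (trans (+-congʳ a₁-trace′) (-‿inverseˡ a₁))) ⟩
      (w * w) * 0# + 0# - 0#
        ≈⟨ solve 2 (λ x w → x :* con 0₃ :+ con 0₃ :- con 0₃ := w :* con 0₃) refl (w * w) w ⟩
      w * 0#
        ∎)
      where
      a₁-trace′ : a₁ ^ Q * ((w * w) * (w * w) ^ q) ≈ - a₁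
      a₁-trace′ = trans (*-congˡ (sym (trans (x^[2j]≈[x*x]^j w (q +ℕ 1)) (^-congʳ (w * w) (ℕ.+-comm q 1))))) a₁-trace

    t≉0 : ¬ t ≈ 0#
    t≉0 t≈0 = 1≉-1 (begin
      1#                              ≈⟨ ^-zeroˡ (suc y) ⟨
      1# ^ suc y                      ≈⟨ ^-congˡ (suc y) (trans (solve 1 (λ m → (:- m) :* (:- m) := m :* m) refl m) m*m≈1) ⟨
      (- m * - m) ^ suc y             ≈⟨ ^-congˡ (suc y) (*-cong s*s≈-m s*s≈-m) ⟨
      (s * s * (s * s)) ^ suc y       ≈⟨ x^[2j]≈[x*x]^j (s * s) (suc y) ⟨
      (s * s) ^ (2 *ℕ suc y)          ≈⟨ ^-congˡ (2 *ℕ suc y) (trans (sym (x^2≈x*x s)) (^-assocʳ a₁ e 2)) ⟩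
      (a₁ ^ (e *ℕ 2)) ^ (2 *ℕ suc y)  ≈⟨ ^-assocʳ a₁ (e *ℕ 2) (2 *ℕ suc y) ⟩
      a₁ ^ (e *ℕ 2 *ℕ (2 *ℕ suc y))   ≈⟨ ^-congʳ a₁ (4e[y+1]≡h y) ⟩
      a₁ ^ h                          ≈⟨ a₁ʰ≈-1 ⟩
      - 1#                            ∎)
      where
      s*s≈-m : s * s ≈ - m
      s*s≈-m = begin
        s * s                                           ≈⟨ solve 3 (λ s m u → s :* s := m :* (s :* (m :* s :+ u)) :+ (con 1₃ :- m :* m) :* (s :* s) :- m :* (u :* s)) refl s m s⁻¹ ⟩
        m * (s * t) + (1# - m * m) * (s * s) - m * (s⁻¹ * s) ≈⟨ +-cong (+-cong (*-congˡ (*-congˡ t≈0)) (*-congʳ (x≈y⇒x-y≈0 (sym m*m≈1)))) (-‿cong (*-congˡ s⁻¹*s≈1)) ⟩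
        m * (s * 0#) + 0# * (s * s) - m * 1#            ≈⟨ solve 2 (λ m x → m :* (x :* con 0₃) :+ con 0₃ :* (x :* x) :- m :* con 1₃ := :- m) refl m s ⟩
        - m                                             ∎

    a₂≉0 : ¬ a₂ ≈ 0#
    a₂≉0 a₂≈0 = *-nonzero (*-nonzero (*-nonzero σ≉0 (^-nonzero k I≉0)) (^-nonzero (suc y) a₁≉0)) t≉0 (trans (sym a₂≈σIᵏa₁^[1+y]t) a₂≈0)
      where
      σ≉0 : ¬ σ ≈ 0#
      σ≉0 σ≈0 = 1≉0 (trans (sym σ*σ≈1) (trans (*-congʳ σ≈0) (zeroˡ σ)))
      I≉0 : ¬ I ≈ 0#
      I≉0 I≈0 = 1≉0 (trans (sym -1*-1≈1) (trans (*-congʳ -1≈0) (zeroˡ _)))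
        where -1≈0 = trans (sym I*I≈-1) (trans (*-congʳ I≈0) (zeroˡ I))

    βwitness : ∃[ β ] (¬ β ≈ 0# × β ^ Q ≈ w * β)
    βwitness = hilbert90 (^-nonzero (suc (2 *ℕ r)) a₁≉0) bᵠ≈-b wᵠ*w≈1
      where
      bᵠ≈-b : (a₁ ^ suc (2 *ℕ r)) ^ Q ≈ - a₁ ^ suc (2 *ℕ r)
      bᵠ≈-b = begin
        (a₁ ^ suc (2 *ℕ r)) ^ Q                                 ≈⟨ [x^j]ᵠ a₁ (suc (2 *ℕ r)) ⟩
        a₁ ^ suc (2 *ℕ r) * a₁ ^ (suc (2 *ℕ r) *ℕ (4 *ℕ r))     ≈⟨ *-congˡ (trans (^-congʳ a₁ ([1+2r]4r≡h y)) a₁ʰ≈-1) ⟩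
        a₁ ^ suc (2 *ℕ r) * - 1#                                ≈⟨ solve 1 (λ b → b :* (:- con 1₃) := :- b) refl _ ⟩
        - a₁ ^ suc (2 *ℕ r)                                     ∎

    β : Carrier
    β = proj₁ βwitness

    β≉0 : ¬ β ≈ 0#
    β≉0 = proj₁ (proj₂ βwitness)

    βᵠ≈wβ : β ^ Q ≈ w * β
    βᵠ≈wβ = proj₂ (proj₂ βwitness)

    V : Carrier → Set (c ⊔ ℓ)
    V = scaledSub β (2 *ℕ k)

    P₁ : (Carrier → Set (c ⊔ ℓ)) → Set (c ⊔ ℓ)
    P₁ W = ∀ z → W z →
             (relTr (2 *ℕ k) 2 (a₂ * (z ^ (2 *ℕ q))) ≈ 0#)
           × ((z ^ 2) * (a₁ + (a₁ ^ q) * (z ^ (2 *ℕ (Q ∸ 1))) + a₂ * (z ^ (Q ∸ 1))) ≈ 0#)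

    P₂ : (Carrier → Set (c ⊔ ℓ)) → Set (c ⊔ ℓ)
    P₂ W = ∀ z → W z →
             (relTr (2 *ℕ k) 2 (a₁ * (z ^ (2 *ℕ (q +ℕ 1)))) ≈ 0#)
           × ((z ^ (q +ℕ 1)) * ((- ((a₁ ^ q) * (z ^ (Q ∸ 1)))) + a₂
                + (a₂ ^ q) * (z ^ ((q +ℕ 1) *ℕ (Q ∸ 1)))) ≈ 0#)

    V-P₁ : P₁ V
    V-P₁ z z∈V = twisted-relTr≈0 (2 *ℕ q) zᵠ≈wz a₂-trace , equation
      where
      zᵠ≈wz = scaledSub-twisted βᵠ≈wβ z∈V
      equation : z ^ 2 * (a₁ + a₁ ^ q * z ^ (2 *ℕ (Q ∸ 1)) + a₂ * z ^ (Q ∸ 1)) ≈ 0#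
      equation = [ (λ z≈0 → trans (*-congʳ (x≈0⇒x^[1+j]≈0 1 z≈0)) (zeroˡ _))
                 , (λ z^[Q-1]≈w → trans (*-congˡ (trans (+-cong (+-congˡ (*-congˡ (z^[2Q-2]≈w*w z^[Q-1]≈w))) (*-congˡ z^[Q-1]≈w)) quadratic)) (zeroʳ _))
                 ]′ (twisted⇒0∨^[Q-1] zᵠ≈wz)
        where
        z^[2Q-2]≈w*w : z ^ (Q ∸ 1) ≈ w → z ^ (2 *ℕ (Q ∸ 1)) ≈ w * w
        z^[2Q-2]≈w*w z^[Q-1]≈w = trans (x^[2j]≈x^j*x^j z (Q ∸ 1)) (*-cong z^[Q-1]≈w z^[Q-1]≈w)

    V-P₂ : P₂ V
    V-P₂ z z∈V = twisted-relTr≈0 (2 *ℕ (q +ℕ 1)) zᵠ≈wz a₁-trace , equation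
      where
      zᵠ≈wz = scaledSub-twisted βᵠ≈wβ z∈V
      equation : z ^ (q +ℕ 1) * (- (a₁ ^ q * z ^ (Q ∸ 1)) + a₂ + a₂ ^ q * z ^ ((q +ℕ 1) *ℕ (Q ∸ 1))) ≈ 0#
      equation = [ (λ z≈0 → trans (*-congʳ (trans (^-congʳ z (ℕ.+-comm q 1)) (x≈0⇒x^[1+j]≈0 q z≈0))) (zeroˡ _))
                 , (λ z^[Q-1]≈w → trans (*-congˡ (trans (+-cong (+-congʳ (-‿cong (*-congˡ z^[Q-1]≈w))) (*-congˡ (z^[[q+1][Q-1]]≈w^[q+1] z^[Q-1]≈w))) second-equation)) (zeroʳ _))
                 ]′ (twisted⇒0∨^[Q-1] zᵠ≈wz)
        where
        z^[[q+1][Q-1]]≈w^[q+1] : z ^ (Q ∸ 1) ≈ w → z ^ ((q +ℕ 1) *ℕ (Q ∸ 1)) ≈ w ^ (q +ℕ 1)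
        z^[[q+1][Q-1]]≈w^[q+1] z^[Q-1]≈w = trans (^-congʳ z (ℕ.*-comm (q +ℕ 1) (Q ∸ 1))) (trans (sym (^-assocʳ z (Q ∸ 1) (q +ℕ 1))) (^-congˡ (q +ℕ 1) z^[Q-1]≈w))

    -- For any other β′, P₁ at z = β′ says that w′ = β′^(Q-1) satisfies the same trace
    -- condition and quadratic as w; the former forces w′² = w², the latter then w′ = w.
    V-unique : ∀ β′ → ¬ β′ ≈ 0# → P₁ (scaledSub β′ (2 *ℕ k)) → SameSet (scaledSub β′ (2 *ℕ k)) V
    V-unique β′ β′≉0 β′-P₁ = scaledSub-⊆ β≉0 β′ᵠ≈wβ′ βᵠ≈wβ , scaledSub-⊆ β′≉0 βᵠ≈wβ β′ᵠ≈wβ′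
      where
      w′ = β′ ^ (Q ∸ 1)
      β′ᵠ≈w′β′ : β′ ^ Q ≈ w′ * β′
      β′ᵠ≈w′β′ = trans (^-congʳ β′ (3^m≡suc (2 *ℕ k))) (*-comm β′ w′)
      β′-conditions = β′-P₁ β′ (1# , ^-zeroˡ Q , sym (*-identityʳ β′))
      a₂-trace′ : a₂ ^ Q * w′ ^ (2 *ℕ q) ≈ - a₂
      a₂-trace′ = relTr≈0⇒twisted (2 *ℕ q) β′≉0 β′ᵠ≈w′β′ (proj₁ β′-conditions)
      quadratic′ : a₁ + a₁ ^ q * (w′ * w′) + a₂ * w′ ≈ 0#
      quadratic′ = [ (λ β′²≈0 → ⊥-elim (^-nonzero 2 β′≉0 β′²≈0))
                   , trans (+-congʳ (+-congˡ (*-congˡ (sym (x^[2j]≈x^j*x^j β′ (Q ∸ 1))))))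
                   ]′ (zero-product (proj₂ β′-conditions))
      w′*w′≈w*w : w′ * w′ ≈ w * w
      w′*w′≈w*w = frobenius-injective k (begin
        (w′ * w′) ^ q  ≈⟨ x^[2j]≈[x*x]^j w′ q ⟨
        w′ ^ (2 *ℕ q)  ≈⟨ *-cancelˡ (^-nonzero Q a₂≉0) (trans a₂-trace′ (sym a₂-trace)) ⟩
        w ^ (2 *ℕ q)   ≈⟨ x^[2j]≈[x*x]^j w q ⟩
        (w * w) ^ q    ∎)
      w′≈w : w′ ≈ w
      w′≈w = [ (λ a₂≈0 → ⊥-elim (a₂≉0 a₂≈0)) , x-y≈0⇒x≈y ]′ (zero-product (begin
        a₂ * (w′ - w)
          ≈⟨ solve 6 (λ A Aq a x y X → a :* (x :- y) := (A :+ Aq :* X :+ a :* x) :- (A :+ Aq :* (y :* y) :+ a :* y) :- Aq :* (X :- y :* y))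
                   refl a₁ (a₁ ^ q) a₂ w′ w (w′ * w′) ⟩
        (a₁ + a₁ ^ q * (w′ * w′) + a₂ * w′) - (a₁ + a₁ ^ q * (w * w) + a₂ * w) - a₁ ^ q * (w′ * w′ - w * w)
          ≈⟨ +-cong (+-cong quadratic′ (-‿cong quadratic)) (-‿cong (*-congˡ (x≈y⇒x-y≈0 w′*w′≈w*w))) ⟩
        0# - 0# - a₁ ^ q * 0#
          ≈⟨ solve 1 (λ x → con 0₃ :- con 0₃ :- x :* con 0₃ := con 0₃) refl (a₁ ^ q) ⟩
        0# ∎))
      β′ᵠ≈wβ′ : β′ ^ Q ≈ w * β′
      β′ᵠ≈wβ′ = trans β′ᵠ≈w′β′ (*-congʳ w′≈w)

    V-supplementary : Supplementary V (Perp V)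
    V-supplementary = scaledSub-supplementary D≉0
      where
      D≉0 : ¬ Tr²ᵐₘ (β * β) ≈ 0#
      D≉0 D≈0 = *-nonzero 1+w*w≉0 (*-nonzero β≉0 β≉0) (begin
        (1# + w * w) * (β * β)       ≈⟨ solve 3 (λ w b x → (con 1₃ :+ w :* w) :* (b :* b) := (w :* b) :* (w :* b) :+ b :* b) refl w β β ⟩
        w * β * (w * β) + β * β      ≈⟨ +-congʳ (*-cong βᵠ≈wβ βᵠ≈wβ) ⟨
        β ^ Q * β ^ Q + β * β        ≈⟨ +-congʳ (^-distrib-* β β Q) ⟨
        Tr²ᵐₘ (β * β)                ≈⟨ D≈0 ⟩
        0#                           ∎)

lemma1 : ∀ {c ℓ : Level} (k : ℕ) → 1 ≤ k → (F : GF3 (4 *ℕ k) c ℓ) →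
  let open GF3 F in
  (a₁ I σ : Carrier) → NonSquare a₁ → Primitive4thRoot I → (σ ≈ 1# ⊎ σ ≈ - 1#) →
  let q = 3 ^ℕ k
      Q = 3 ^ℕ (2 *ℕ k)
      e = ((q ∸ 1) *ℕ (Q +ℕ 1)) / 4
      a₂ = σ * (I ^ k) * (a₁ ^ ((q +ℕ 1) / 2))
             * (((- 1#) ^ k) * (a₁ ^ e) + ((a₁ ⁻¹) ^ e))
      P₁ : (Carrier → Set (c ⊔ ℓ)) → Set (c ⊔ ℓ)
      P₁ V = ∀ z → V z →
               (relTr (2 *ℕ k) 2 (a₂ * (z ^ (2 *ℕ q))) ≈ 0#)
             × ((z ^ 2) * (a₁ + (a₁ ^ q) * (z ^ (2 *ℕ (Q ∸ 1))) + a₂ * (z ^ (Q ∸ 1))) ≈ 0#)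
      P₂ : (Carrier → Set (c ⊔ ℓ)) → Set (c ⊔ ℓ)
      P₂ V = ∀ z → V z →
               (relTr (2 *ℕ k) 2 (a₁ * (z ^ (2 *ℕ (q +ℕ 1)))) ≈ 0#)
             × ((z ^ (q +ℕ 1)) * ((- ((a₁ ^ q) * (z ^ (Q ∸ 1)))) + a₂
                  + (a₂ ^ q) * (z ^ ((q +ℕ 1) *ℕ (Q ∸ 1)))) ≈ 0#)
  in ∃[ β ] ( ¬ (β ≈ 0#)
            × P₁ (scaledSub β (2 *ℕ k))
            × (∀ β′ → ¬ (β′ ≈ 0#) → P₁ (scaledSub β′ (2 *ℕ k))
                 → SameSet (scaledSub β′ (2 *ℕ k)) (scaledSub β (2 *ℕ k)))
            × P₂ (scaledSub β (2 *ℕ k))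
            × IsSubspace (Perp (scaledSub β (2 *ℕ k)))
            × Supplementary (scaledSub β (2 *ℕ k)) (Perp (scaledSub β (2 *ℕ k))))
lemma1 k k≥1 F a₁ I σ a₁-nonsquare I-primitive σ≈±1 =
  β , β≉0 , V-P₁ , V-unique , V-P₂ , FiniteField.Perp-isSubspace F V , V-supplementary
  where open Construction.Solution k k≥1 F a₁ I σ a₁-nonsquare I-primitive σ≈±1
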